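{- Let $p$ be an odd prime and let $N_{p-2}$ be the number of permutations of $p-2$ letters with an even number of ascents. Then $$\sum_{k=1}^{p-1}\frac{(-1)^k}{k}\equiv 2\bigl(1-2N_{p-2}\bigr)\pmod p.$$
   Context: Congruences between rationals with denominators prime to $p$ are taken in $\mathbb{Z}_{(p)}$ (or $\mathbb{Z}_p$). For a permutation $(i_1,\dots,i_n)$ of $\{1,\dots,n\}$ (mapping $j$ to $i_j$), an ascent is an index $k$ with $i_{k+1}>i_k$. -}

module Defs where

open import Data.Nat as ℕ using (ℕ; zero; suc; _%_)
open import Data.Nat.Coprimality using (Coprime)
open import Data.Integer as ℤ using (ℤ; +_; -[1+_])
open import Data.Rational as ℚ using (ℚ; ↧ₙ_)
open import Data.Fin as Fin using (Fin)
open import Data.Fin.Properties using () renaming (_≟_ to _≟ᶠ_)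
open import Data.Vec as Vec using (Vec; []; _∷_; toList)
open import Data.List as List using (List; [_]; length; filter; concatMap; allFin)
open import Data.Bool using (if_then_else_)
open import Data.Product using (∃; _×_)
open import Relation.Binary.PropositionalEquality using (_≡_)
open import Relation.Nullary.Decidable using (_×-dec_)
import Data.List.Relation.Unary.Unique.DecPropositional as UniqueDec

allVecs : (k n : ℕ) → List (Vec (Fin n) k)
allVecs zero    n = [ [] ]
allVecs (suc k) n = concatMap (λ i → List.map (i ∷_) (allVecs k n)) (allFin n)

ascentsL : ∀ {n} → List (Fin n) → ℕ
ascentsL (x List.∷ y List.∷ xs) =
  (if Fin.toℕ x ℕ.<ᵇ Fin.toℕ y then 1 else 0) ℕ.+ ascentsL (y List.∷ xs)
ascentsL _ = 0

ascents : ∀ {n} → Vec (Fin n) n → ℕ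
ascents v = ascentsL (toList v)

-- A permutation of n letters (letters 0,…,n-1 in Fin n) given in one-line
-- notation (i_1,…,i_n): a length-n vector over Fin n with distinct entries.
IsPerm : ∀ {n} → Vec (Fin n) n → Set
IsPerm {n} v = UniqueDec.Unique _≟ᶠ_ (toList v)

EvenAscents : ∀ {n} → Vec (Fin n) n → Set
EvenAscents v = ascents v % 2 ≡ 0

N : ℕ → ℕ
N n = length (filter (λ v → UniqueDec.unique? _≟ᶠ_ (toList v) ×-dec (ascents v % 2 ℕ.≟ 0)) (allVecs n n))

altHarmonic : ℕ → ℚ
altHarmonic zero    = ℚ.0ℚ
altHarmonic (suc m) = altHarmonic m ℚ.+ ((ℤ.-1ℤ ℤ.^ suc m) ℚ./ suc m)

-- Congruence a ≡ b (mod p) in ℤ_(p): a - b = p·c with c ∈ ℤ_(p).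
_≡_[modℚ_] : ℚ → ℚ → ℕ → Set
a ≡ b [modℚ p ] = ∃ λ (c : ℚ) → Coprime (↧ₙ c) p × (a ℚ.- b ≡ ((+ p) ℚ./ 1) ℚ.* c)

module Submission where

-- Write n = p - 2 and A(n,k) for the Eulerian numbers. The proof has three parts.
--  * Combinatorics (RangeSum, Binomial, Eulerian, Permutations): inserting the
--    largest letter shows that A(n,k) counts permutations with k ascents, so
--    N = Σ_k A(n,k)[k even]; Worpitzky's identity (j+1)^n = Σ_k A(n,k) C(n+j-k, n)
--    is proved from the recurrence.
--  * Arithmetic modulo p (Congruence, Fermat, SummationByParts, EvenAscentCount,
--    WorpitzkyModPrime, HarmonicModPrime): modulo p Worpitzky's identity reads
--    A(n,m) - A(n,m-1) ≡ (m+1)^n ≡ 1/(m+1); summation by parts then gives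
--    Σ_k A(n,k) ≡ 1 and 2 Σ_k (-1)^k A(n,k) ≡ Σ_{m<p-1} (-1)^m/(m+1), and
--    2N = Σ_k A(n,k) + Σ_k (-1)^k A(n,k) yields the congruence multiplied by (p-1)!.
--  * Rationals (Rationals, RationalCongruence): (p-1)! is prime to p, so the
--    integer congruence divides out to the stated congruence in ℤ_(p).

open import Defs
open import Data.Nat using (ℕ; zero; suc; _<_; _≤_; s≤s; z≤n)
open import Data.Nat.Properties as ℕP using (m<n⇒m<1+n; n<1+n)
open import Data.Nat.Primality using (Prime)
open import Data.Integer using (ℤ)
import Data.Integer.Properties as ℤP
open import Algebra.Bundles using (CommutativeSemiring)

module RangeSum {c ℓ} (R : CommutativeSemiring c ℓ) where
  open CommutativeSemiring R
  open import Algebra.Properties.CommutativeSemigroup +-commutativeSemigroup using (interchange)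
  open import Relation.Binary.Reasoning.Setoid setoid

  sum : ℕ → (ℕ → Carrier) → Carrier
  sum zero    f = 0#
  sum (suc L) f = sum L f + f L

  sum-cong : ∀ L {f g} → (∀ k → k < L → f k ≈ g k) → sum L f ≈ sum L g
  sum-cong zero    _ = refl
  sum-cong (suc L) f≈g = +-cong (sum-cong L (λ k k<L → f≈g k (m<n⇒m<1+n k<L))) (f≈g L (n<1+n L))

  sum-zero : ∀ L → sum L (λ _ → 0#) ≈ 0#
  sum-zero zero    = refl
  sum-zero (suc L) = trans (+-identityʳ _) (sum-zero L)

  sum-+ : ∀ L f g → sum L (λ k → f k + g k) ≈ sum L f + sum L g
  sum-+ zero    f g = sym (+-identityʳ 0#)
  sum-+ (suc L) f g = begin
    sum L (λ k → f k + g k) + (f L + g L) ≈⟨ +-congʳ (sum-+ L f g) ⟩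
    (sum L f + sum L g) + (f L + g L)     ≈⟨ interchange _ _ _ _ ⟩
    (sum L f + f L) + (sum L g + g L)     ∎

  sum-*ˡ : ∀ L a f → sum L (λ k → a * f k) ≈ a * sum L f
  sum-*ˡ zero    a f = sym (zeroʳ a)
  sum-*ˡ (suc L) a f = begin
    sum L (λ k → a * f k) + a * f L ≈⟨ +-congʳ (sum-*ˡ L a f) ⟩
    a * sum L f + a * f L           ≈⟨ sym (distribˡ a (sum L f) (f L)) ⟩
    a * (sum L f + f L)             ∎

  sum-shift : ∀ L f → sum (suc L) f ≈ f 0 + sum L (λ k → f (suc k))
  sum-shift zero    f = trans (+-identityˡ (f 0)) (sym (+-identityʳ (f 0)))
  sum-shift (suc L) f = begin
    sum (suc L) f + f (suc L)                 ≈⟨ +-congʳ (sum-shift L f) ⟩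
    f 0 + sum L (λ k → f (suc k)) + f (suc L) ≈⟨ +-assoc (f 0) _ _ ⟩
    f 0 + (sum L (λ k → f (suc k)) + f (suc L)) ∎

module Σℕ = RangeSum ℕP.+-*-commutativeSemiring

module Binomial where
  open import Data.Nat using (_+_; _*_; _^_; s≤s)
  open ℕP
  open import Algebra.Properties.CommutativeSemigroup *-commutativeSemigroup using (x∙yz≈y∙xz)
  open import Relation.Binary.PropositionalEquality
  open ≡-Reasoning
  open Σℕ using (sum; sum-cong; sum-+; sum-*ˡ; sum-shift)

  C : ℕ → ℕ → ℕ
  C _       zero    = 1
  C zero    (suc k) = 0
  C (suc m) (suc k) = C m k + C m (suc k)

  C-1 : ∀ m → C m 1 ≡ m
  C-1 zero    = refl
  C-1 (suc m) = cong suc (C-1 m)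

  C-above : ∀ m k → m < k → C m k ≡ 0
  C-above zero    (suc k) _         = refl
  C-above (suc m) (suc k) (s≤s m<k) = cong₂ _+_ (C-above m k m<k) (C-above m (suc k) (m<n⇒m<1+n m<k))

  C-diag : ∀ m → C m m ≡ 1
  C-diag zero    = refl
  C-diag (suc m) = cong₂ _+_ (C-diag m) (C-above m (suc m) (n<1+n m))

  absorb : ∀ m k → suc k * C (suc m) (suc k) ≡ suc m * C m k
  absorb zero    zero    = refl
  absorb zero    (suc k) = *-zeroʳ (suc (suc k))
  absorb (suc m) zero    = begin
    1 * (1 + C (suc m) 1) ≡⟨ *-identityˡ _ ⟩
    suc (C (suc m) 1)     ≡⟨ cong suc (C-1 (suc m)) ⟩
    suc (suc m)           ≡⟨ sym (*-identityʳ _) ⟩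
    suc (suc m) * 1       ∎
  absorb (suc m) (suc k) = begin
    suc (suc k) * (C (suc m) (suc k) + C (suc m) (suc (suc k)))
      ≡⟨ *-distribˡ-+ (suc (suc k)) (C (suc m) (suc k)) _ ⟩
    suc (suc k) * C (suc m) (suc k) + suc (suc k) * C (suc m) (suc (suc k))
      ≡⟨ cong₂ (λ x y → C (suc m) (suc k) + x + y) (absorb m k) (absorb m (suc k)) ⟩
    C (suc m) (suc k) + suc m * C m k + suc m * C m (suc k)
      ≡⟨ +-assoc (C (suc m) (suc k)) _ _ ⟩
    C (suc m) (suc k) + (suc m * C m k + suc m * C m (suc k))
      ≡⟨ cong (C (suc m) (suc k) +_) (sym (*-distribˡ-+ (suc m) (C m k) _)) ⟩
    suc (suc m) * C (suc m) (suc k) ∎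

  binomial-theorem : ∀ a m → (suc a) ^ m ≡ sum (suc m) (λ i → C m i * a ^ i)
  binomial-theorem a zero    = refl
  binomial-theorem a (suc m) = begin
    suc a ^ m + a * suc a ^ m
      ≡⟨ cong₂ (λ x y → x + a * y) (binomial-theorem a m) (binomial-theorem a m) ⟩
    sum (suc m) term + a * sum (suc m) term
      ≡⟨ cong₂ _+_ (sum-shift m term) (sym (sum-*ˡ (suc m) a term)) ⟩
    (1 + sum m (λ i → term (suc i))) + sum (suc m) (λ i → a * term i)
      ≡⟨ cong₂ (λ x y → (1 + x) + y) top-vanishes (sum-cong (suc m) (λ i _ → a*term i)) ⟩
    (1 + sum (suc m) shifted) + sum (suc m) lower
      ≡⟨ trans (+-assoc 1 (sum (suc m) shifted) _) (cong (1 +_) (+-comm (sum (suc m) shifted) _)) ⟩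
    1 + (sum (suc m) lower + sum (suc m) shifted)
      ≡⟨ cong (1 +_) (sym (sum-+ (suc m) lower shifted)) ⟩
    1 + sum (suc m) (λ i → lower i + shifted i)
      ≡⟨ cong (1 +_) (sum-cong (suc m) (λ i _ → sym (*-distribʳ-+ (a ^ suc i) (C m i) _))) ⟩
    1 + sum (suc m) (λ i → C (suc m) (suc i) * a ^ suc i)
      ≡⟨ sym (sum-shift (suc m) (λ i → C (suc m) i * a ^ i)) ⟩
    sum (suc (suc m)) (λ i → C (suc m) i * a ^ i) ∎
    where
    term lower shifted : ℕ → ℕ
    term    i = C m i * a ^ i
    lower   i = C m i * a ^ suc i
    shifted i = C m (suc i) * a ^ suc i
    a*term : ∀ i → a * term i ≡ lower i
    a*term i = x∙yz≈y∙xz a (C m i) (a ^ i)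
    top-vanishes : sum m (λ i → term (suc i)) ≡ sum (suc m) shifted
    top-vanishes = begin
      sum m shifted           ≡⟨ sym (+-identityʳ _) ⟩
      sum m shifted + 0       ≡⟨ cong (λ c → sum m shifted + c * a ^ suc m) (sym (C-above m (suc m) (n<1+n m))) ⟩
      sum (suc m) shifted     ∎

  B : ℕ → ℕ → ℕ
  B n a = C (n + a) a

  B-1 : ∀ n → B n 1 ≡ suc n
  B-1 n = trans (C-1 (n + 1)) (+-comm n 1)

  B-stepˡ : ∀ n l → suc l * B n (suc l) ≡ suc (n + l) * B n l
  B-stepˡ n l = begin
    suc l * C (n + suc l) (suc l)   ≡⟨ cong (λ z → suc l * C z (suc l)) (+-suc n l) ⟩
    suc l * C (suc (n + l)) (suc l) ≡⟨ absorb (n + l) l ⟩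
    suc (n + l) * C (n + l) l       ∎

  -- (n + 1) B(n+1, a) = (a + 1) B(n, a+1): both are (n+a+1)!/(n! a!).
  B-trade : ∀ n a → suc n * B (suc n) a ≡ suc a * B n (suc a)
  B-trade n a = +-cancelʳ-≡ (suc a * c) _ _ (begin
    suc n * c + suc a * c                 ≡⟨ sym (*-distribʳ-+ c (suc n) (suc a)) ⟩
    (suc n + suc a) * c                   ≡⟨ cong (λ z → suc z * c) (+-suc n a) ⟩
    suc (suc (n + a)) * c                 ≡⟨ sym (absorb (suc (n + a)) a) ⟩
    suc a * C (suc (suc (n + a))) (suc a) ≡⟨ *-distribˡ-+ (suc a) c _ ⟩
    suc a * c + suc a * C (suc (n + a)) (suc a) ≡⟨ +-comm (suc a * c) _ ⟩
    suc a * C (suc (n + a)) (suc a) + suc a * c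
      ≡⟨ cong (λ z → suc a * C z (suc a) + suc a * c) (sym (+-suc n a)) ⟩
    suc a * B n (suc a) + suc a * c       ∎)
    where c = C (suc (n + a)) a

  B-stepʳ : ∀ n a → suc n * B (suc n) (suc a) ≡ suc (suc (n + a)) * B n (suc a)
  B-stepʳ n a = *-cancelˡ-≡ _ _ (suc a) (begin
    suc a * (suc n * B (suc n) (suc a))       ≡⟨ x∙yz≈y∙xz (suc a) (suc n) (B (suc n) (suc a)) ⟩
    suc n * (suc a * B (suc n) (suc a))       ≡⟨ cong (suc n *_) (B-stepˡ (suc n) a) ⟩
    suc n * (suc (suc n + a) * B (suc n) a)   ≡⟨ x∙yz≈y∙xz (suc n) (suc (suc n + a)) (B (suc n) a) ⟩
    suc (suc (n + a)) * (suc n * B (suc n) a) ≡⟨ cong (suc (suc (n + a)) *_) (B-trade n a) ⟩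
    suc (suc (n + a)) * (suc a * B n (suc a)) ≡⟨ x∙yz≈y∙xz (suc (suc (n + a))) (suc a) (B n (suc a)) ⟩
    suc a * (suc (suc (n + a)) * B n (suc a)) ∎)

module Eulerian where
  open import Data.Nat using (_+_; _*_; _∸_; _^_; _≤_; _≤?_; s≤s)
  open ℕP
  open import Algebra.Properties.CommutativeSemigroup *-commutativeSemigroup using (x∙yz≈y∙xz)
  open import Data.Nat.Tactic.RingSolver using (solve-∀)
  open import Relation.Binary.PropositionalEquality
  open import Relation.Nullary using (yes; no)
  open ≡-Reasoning
  open Σℕ using (sum; sum-cong; sum-zero; sum-+; sum-*ˡ; sum-shift)
  open Binomial

  A : ℕ → ℕ → ℕ
  A zero    zero    = 1
  A zero    (suc k) = 0
  A (suc n) zero    = A n zero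
  A (suc n) (suc k) = suc (suc k) * A n (suc k) + (n ∸ k) * A n k

  A-0 : ∀ n → A n 0 ≡ 1
  A-0 zero    = refl
  A-0 (suc n) = A-0 n

  A-above : ∀ n k → n < k → A n k ≡ 0
  A-above zero    (suc k) _         = refl
  A-above (suc n) (suc k) (s≤s n<k) = trans
    (cong₂ (λ x y → suc (suc k) * x + (n ∸ k) * y) (A-above n (suc k) (m<n⇒m<1+n n<k)) (A-above n k n<k))
    (cong₂ _+_ (*-zeroʳ (suc (suc k))) (*-zeroʳ (n ∸ k)))

  A-diag : ∀ {n} → 1 ≤ n → A n n ≡ 0
  A-diag {suc n} _ = trans (cong₂ (λ x y → suc (suc n) * x + y * A n n) (A-above n (suc n) (n<1+n n)) (n∸n≡0 n))
                   (trans (+-identityʳ _) (*-zeroʳ (suc (suc n))))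

  sum-recurrence : ∀ n L (g : ℕ → ℕ) →
    sum (suc L) (λ k → A (suc n) k * g k)
      ≡ sum (suc L) (λ k → suc k * A n k * g k) + sum L (λ k → (n ∸ k) * A n k * g (suc k))
  sum-recurrence n L g = begin
    sum (suc L) (λ k → A (suc n) k * g k)
      ≡⟨ sum-shift L _ ⟩
    A n 0 * g 0 + sum L (λ k → A (suc n) (suc k) * g (suc k))
      ≡⟨ cong (A n 0 * g 0 +_) (trans (sum-cong L (λ k _ → *-distribʳ-+ (g (suc k)) (suc (suc k) * A n (suc k)) ((n ∸ k) * A n k))) (sum-+ L _ _)) ⟩
    A n 0 * g 0 + (sum L (λ k → up (suc k)) + sum L down)
      ≡⟨ sym (+-assoc (A n 0 * g 0) (sum L (λ k → up (suc k))) (sum L down)) ⟩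
    A n 0 * g 0 + sum L (λ k → up (suc k)) + sum L down
      ≡⟨ cong (λ x → x + sum L (λ k → up (suc k)) + sum L down) (sym (cong (_* g 0) (*-identityˡ (A n 0)))) ⟩
    up 0 + sum L (λ k → up (suc k)) + sum L down
      ≡⟨ cong (_+ sum L down) (sym (sum-shift L up)) ⟩
    sum (suc L) up + sum L down ∎
    where
    up down : ℕ → ℕ
    up   k = suc k * A n k * g k
    down k = (n ∸ k) * A n k * g (suc k)

  sum-transfer : ∀ n (f : ℕ → ℕ) →
    sum (suc n) (λ k → A n k * (suc k * f k + (n ∸ k) * f (suc k)))
      ≡ sum (suc (suc n)) (λ k → A (suc n) k * f k)
  sum-transfer n f = begin
    sum (suc n) (λ k → A n k * (suc k * f k + (n ∸ k) * f (suc k)))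
      ≡⟨ trans (sum-cong (suc n) (λ k _ → distribute (A n k) (suc k) (f k) (n ∸ k) (f (suc k)))) (sum-+ (suc n) up down) ⟩
    sum (suc n) up + sum (suc n) down
      ≡⟨ cong (_+ sum (suc n) down) (trans (sym (+-identityʳ _)) (cong (sum (suc n) up +_) (sym top))) ⟩
    sum (suc (suc n)) up + sum (suc n) down
      ≡⟨ sym (sum-recurrence n (suc n) f) ⟩
    sum (suc (suc n)) (λ k → A (suc n) k * f k) ∎
    where
    up down : ℕ → ℕ
    up   k = suc k * A n k * f k
    down k = (n ∸ k) * A n k * f (suc k)
    distribute : ∀ a b c d e → a * (b * c + d * e) ≡ b * a * c + d * a * e
    distribute = solve-∀
    top : up (suc n) ≡ 0
    top = trans (cong (λ x → suc (suc n) * x * f (suc n)) (A-above n (suc n) (n<1+n n)))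
                (cong (_* f (suc n)) (*-zeroʳ (suc (suc n))))


  worpitzky-coefficients : ∀ n k a → k ≤ n →
    suc k * B (suc n) (suc a) + (n ∸ k) * B (suc n) a ≡ suc (suc (k + a)) * B n (suc a)
  worpitzky-coefficients n k a k≤n =
    subst (λ m → suc k * B (suc m) (suc a) + (n ∸ k) * B (suc m) a ≡ suc (suc (k + a)) * B m (suc a))
          (m+[n∸m]≡n k≤n) (split k (n ∸ k))
    where
    split : ∀ k d → suc k * B (suc (k + d)) (suc a) + d * B (suc (k + d)) a ≡ suc (suc (k + a)) * B (k + d) (suc a)
    split k d = *-cancelˡ-≡ _ _ (suc (k + d)) (begin
      suc (k + d) * (suc k * Y + d * Z)                   ≡⟨ expand k d Y Z ⟩
      suc k * (suc (k + d) * Y) + d * (suc (k + d) * Z)   ≡⟨ cong₂ (λ u v → suc k * u + d * v) (B-stepʳ (k + d) a) (B-trade (k + d) a) ⟩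
      suc k * (suc (suc (k + d + a)) * X) + d * (suc a * X) ≡⟨ collect k d a X ⟩
      suc (k + d) * (suc (suc (k + a)) * X)               ∎)
      where
      X = B (k + d) (suc a)
      Y = B (suc (k + d)) (suc a)
      Z = B (suc (k + d)) a
      expand : ∀ k d Y Z → suc (k + d) * (suc k * Y + d * Z) ≡ suc k * (suc (k + d) * Y) + d * (suc (k + d) * Z)
      expand = solve-∀
      collect : ∀ k d a X → suc k * (suc (suc (k + d + a)) * X) + d * (suc a * X) ≡ suc (k + d) * (suc (suc (k + a)) * X)
      collect = solve-∀

  -- The summand of Worpitzky's recursion, for every k (A n k = 0 when k > n).
  worpitzky-term : ∀ n k a →
    suc k * A n k * B (suc n) (suc a) + (n ∸ k) * A n k * B (suc n) a ≡ suc (suc (k + a)) * (A n k * B n (suc a))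
  worpitzky-term n k a with k ≤? n
  ... | yes k≤n = begin
    suc k * A n k * B (suc n) (suc a) + (n ∸ k) * A n k * B (suc n) a
      ≡⟨ factor (suc k) (n ∸ k) (A n k) _ _ ⟩
    A n k * (suc k * B (suc n) (suc a) + (n ∸ k) * B (suc n) a)
      ≡⟨ cong (A n k *_) (worpitzky-coefficients n k a k≤n) ⟩
    A n k * (suc (suc (k + a)) * B n (suc a))
      ≡⟨ x∙yz≈y∙xz (A n k) (suc (suc (k + a))) _ ⟩
    suc (suc (k + a)) * (A n k * B n (suc a)) ∎
    where factor : ∀ x y z u v → x * z * u + y * z * v ≡ z * (x * u + y * v)
          factor = solve-∀
  ... | no k≰n rewrite A-above n k (≰⇒> k≰n) =
    trans (cong₂ (λ x y → x * B (suc n) (suc a) + y * B (suc n) a) (*-zeroʳ (suc k)) (*-zeroʳ (n ∸ k)))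
          (sym (*-zeroʳ (suc (suc (k + a)))))

  worpitzky : ∀ n j → sum (suc j) (λ k → A n k * B n (j ∸ k)) ≡ suc j ^ n
  worpitzky zero j = begin
    sum (suc j) (λ k → A zero k * B zero (j ∸ k))   ≡⟨ sum-shift j _ ⟩
    1 * C j j + sum j (λ _ → 0)                     ≡⟨ cong₂ _+_ (trans (*-identityˡ _) (C-diag j)) (sum-zero j) ⟩
    1                                               ∎
  worpitzky (suc n) zero = trans (cong (_* 1) (A-0 n)) (sym (^-zeroˡ (suc n)))
  worpitzky (suc n) (suc j′) = begin
    sum (suc j) (λ k → A (suc n) k * B (suc n) (j ∸ k))
      ≡⟨ sum-recurrence n j (λ k → B (suc n) (j ∸ k)) ⟩
    sum j up + up j + sum j down
      ≡⟨ swap (sum j up) (up j) (sum j down) ⟩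
    sum j up + sum j down + up j
      ≡⟨ cong₂ _+_ (trans (sym (sum-+ j up down)) (sum-cong j pair)) last ⟩
    sum j (λ k → suc j * w k) + suc j * w j
      ≡⟨ sum-*ˡ (suc j) (suc j) w ⟩
    suc j * sum (suc j) w
      ≡⟨ cong (suc j *_) (worpitzky n j) ⟩
    suc j * suc j ^ n ∎
    where
    j = suc j′
    up down w : ℕ → ℕ
    up   k = suc k * A n k * B (suc n) (j ∸ k)
    down k = (n ∸ k) * A n k * B (suc n) (j′ ∸ k)
    w    k = A n k * B n (j ∸ k)
    swap : ∀ x y z → x + y + z ≡ x + z + y
    swap = solve-∀
    pair : ∀ k → k < j → up k + down k ≡ suc j * w k
    pair k (s≤s k≤j′) = begin
      up k + down k
        ≡⟨ cong (λ z → suc k * A n k * B (suc n) z + down k) (+-∸-assoc 1 k≤j′) ⟩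
      suc k * A n k * B (suc n) (suc (j′ ∸ k)) + down k
        ≡⟨ worpitzky-term n k (j′ ∸ k) ⟩
      suc (suc (k + (j′ ∸ k))) * (A n k * B n (suc (j′ ∸ k)))
        ≡⟨ cong₂ (λ u v → suc (suc u) * (A n k * B n v)) (m+[n∸m]≡n k≤j′) (sym (+-∸-assoc 1 k≤j′)) ⟩
      suc j * w k ∎
    last : up j ≡ suc j * w j
    last = trans (*-assoc (suc j) (A n j) _)
                 (cong (λ z → suc j * (A n j * z)) (trans (cong (B (suc n)) (n∸n≡0 j)) (sym (cong (B n) (n∸n≡0 j)))))

-- Every permutation of n + 1 letters arises exactly once by inserting the
-- largest letter n into a permutation of n letters at one of n + 1 positions,
-- and the insertion changes the number of ascents in a controlled way.
module Permutations where
  open import Data.Nat using (_+_; _*_; _∸_; _≤_; _%_; _≟_; _<ᵇ_; s≤s; z≤n)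
  open ℕP using (+-assoc; +-comm; +-identityʳ; m≤n⇒m≤1+n)
  open import Data.Nat.ListAction using (sum)
  open import Data.Nat.ListAction.Properties using (sum-++; sum-↭)
  open import Data.Bool using (true; false; if_then_else_; T)
  open import Data.Fin as Fin using (Fin; toℕ; fromℕ; inject₁; punchIn; punchOut; lower₁)
  import Data.Fin.Properties as FinP
  open import Data.Fin.Properties using () renaming (_≟_ to _≟ᶠ_)
  open import Data.Vec as Vec using (Vec; []; _∷_; toList; insertAt; removeAt; lookup; tabulate)
  import Data.Vec.Properties as VecP
  open import Data.Vec.Relation.Unary.All as AllV using ([]; _∷_)
  import Data.Vec.Relation.Unary.All.Properties as AllVP
  open import Data.List as List using (List; []; _∷_; _++_; filter; concatMap; allFin; cartesianProductWith; length)
  import Data.List.Properties as ListP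
  open import Data.List.Relation.Unary.All as AllL using ([]; _∷_)
  open import Data.List.Relation.Unary.AllPairs using ([]; _∷_)
  open import Data.List.Relation.Unary.Any using (here)
  open import Data.List.Membership.Propositional using (_∈_)
  open import Data.List.Membership.Propositional.Properties
    using (∈-filter⁺; ∈-filter⁻; ∈-allFin; ∈-cartesianProductWith⁺; ∈-cartesianProductWith⁻)
  open import Data.List.Membership.Propositional.Properties.WithK using (unique∧set⇒bag)
  import Data.List.Relation.Unary.Unique.Propositional as UP
  import Data.List.Relation.Unary.Unique.Propositional.Properties as UPP
  import Data.List.Relation.Unary.Unique.DecPropositional as UniqueDec
  open import Data.List.Relation.Binary.BagAndSetEquality using (∼bag⇒↭)
  open import Data.List.Relation.Binary.Permutation.Propositional using (_↭_)
  import Data.List.Relation.Binary.Permutation.Propositional.Properties as PermP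
  open import Data.Product using (∃; ∃₂; _×_; _,_; proj₁; proj₂)
  open import Data.Sum using (_⊎_; inj₁; inj₂)
  open import Data.Empty using (⊥-elim)
  open import Function.Bundles using (mk⇔)
  open import Relation.Nullary using (Dec; yes; no; does; ¬_)
  open import Relation.Nullary.Decidable using (_×-dec_)
  open import Relation.Binary.PropositionalEquality
  open ≡-Reasoning
  open Eulerian using (A; sum-transfer)

  sumOver : ∀ {X : Set} → (X → ℕ) → List X → ℕ
  sumOver g xs = sum (List.map g xs)

  sumFin : ∀ {k} → (Fin k → ℕ) → ℕ
  sumFin g = sum (List.tabulate g)

  sumOver-↭ : ∀ {X : Set} (g : X → ℕ) {xs ys} → xs ↭ ys → sumOver g xs ≡ sumOver g ys
  sumOver-↭ g p = sum-↭ (PermP.map⁺ g p)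

  sumOver-cong : ∀ {X : Set} {g h : X → ℕ} xs → (∀ x → g x ≡ h x) → sumOver g xs ≡ sumOver h xs
  sumOver-cong xs g≗h = cong sum (ListP.map-cong g≗h xs)

  sumOver-product : ∀ {X Y : Set} {k} (g : Y → ℕ) (F : X → Fin k → Y) xs →
    sumOver g (cartesianProductWith F xs (allFin k)) ≡ sumOver (λ x → sumFin (λ i → g (F x i))) xs
  sumOver-product g F [] = refl
  sumOver-product {k = k} g F (x ∷ xs) = begin
    sum (List.map g (List.map (F x) (allFin k) ++ cartesianProductWith F xs (allFin k)))
      ≡⟨ cong sum (ListP.map-++ g (List.map (F x) (allFin k)) _) ⟩
    sum (List.map g (List.map (F x) (allFin k)) ++ List.map g (cartesianProductWith F xs (allFin k)))
      ≡⟨ sum-++ (List.map g (List.map (F x) (allFin k))) _ ⟩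
    sumOver g (List.map (F x) (allFin k)) + sumOver g (cartesianProductWith F xs (allFin k))
      ≡⟨ cong₂ _+_ (cong (sumOver g) (ListP.map-tabulate (λ i → i) (F x))) (sumOver-product g F xs) ⟩
    sumOver g (List.tabulate (F x)) + sumOver (λ x → sumFin (λ i → g (F x i))) xs
      ≡⟨ cong (λ l → sum l + _) (ListP.map-tabulate (F x) g) ⟩
    sumFin (λ i → g (F x i)) + sumOver (λ x → sumFin (λ i → g (F x i))) xs ∎

  Distinct : ∀ {n k} → Vec (Fin n) k → Set
  Distinct v = UniqueDec.Unique _≟ᶠ_ (toList v)

  LookupInjective : ∀ {X : Set} {k} → Vec X k → Set
  LookupInjective {k = k} v = ∀ (i j : Fin k) → lookup v i ≡ lookup v j → i ≡ j

  All⇒lookup : ∀ {X : Set} {P : X → Set} {k} (v : Vec X k) → AllL.All P (toList v) → ∀ j → P (lookup v j)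
  All⇒lookup (x ∷ v) (px ∷ _)  Fin.zero    = px
  All⇒lookup (x ∷ v) (_  ∷ pv) (Fin.suc j) = All⇒lookup v pv j

  lookup⇒All : ∀ {X : Set} {P : X → Set} {k} (v : Vec X k) → (∀ j → P (lookup v j)) → AllL.All P (toList v)
  lookup⇒All []      _  = []
  lookup⇒All (x ∷ v) pv = pv Fin.zero ∷ lookup⇒All v (λ j → pv (Fin.suc j))

  distinct⇒injective : ∀ {n k} (v : Vec (Fin n) k) → Distinct v → LookupInjective v
  distinct⇒injective (x ∷ v) (x∉v ∷ _) Fin.zero    Fin.zero    _  = refl
  distinct⇒injective (x ∷ v) (x∉v ∷ _) Fin.zero    (Fin.suc j) eq = ⊥-elim (All⇒lookup v x∉v j eq)
  distinct⇒injective (x ∷ v) (x∉v ∷ _) (Fin.suc i) Fin.zero    eq = ⊥-elim (All⇒lookup v x∉v i (sym eq))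
  distinct⇒injective (x ∷ v) (_ ∷ dv)  (Fin.suc i) (Fin.suc j) eq = cong Fin.suc (distinct⇒injective v dv i j eq)

  injective⇒distinct : ∀ {n k} (v : Vec (Fin n) k) → LookupInjective v → Distinct v
  injective⇒distinct []      _   = []
  injective⇒distinct (x ∷ v) inj =
    lookup⇒All v (λ j eq → FinP.0≢1+n (inj Fin.zero (Fin.suc j) eq))
    ∷ injective⇒distinct v (λ i j eq → FinP.suc-injective (inj (Fin.suc i) (Fin.suc j) eq))

  allVecs-product : ∀ k n → allVecs (suc k) n ≡ cartesianProductWith _∷_ (allFin n) (allVecs k n)
  allVecs-product k n = go (allFin n)
    where go : ∀ xs → concatMap (λ i → List.map (i ∷_) (allVecs k n)) xs ≡ cartesianProductWith _∷_ xs (allVecs k n)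
          go []       = refl
          go (x ∷ xs) = cong (List.map (x ∷_) (allVecs k n) ++_) (go xs)

  allVecs-unique : ∀ k n → UP.Unique (allVecs k n)
  allVecs-unique zero    n = [] ∷ []
  allVecs-unique (suc k) n = subst UP.Unique (sym (allVecs-product k n))
    (UPP.cartesianProductWith⁺ _∷_ VecP.∷-injective (UPP.allFin⁺ n) (allVecs-unique k n))

  allVecs-complete : ∀ {k n} (v : Vec (Fin n) k) → v ∈ allVecs k n
  allVecs-complete []                = here refl
  allVecs-complete {suc k} {n} (x ∷ v) = subst ((x ∷ v) ∈_) (sym (allVecs-product k n))
    (∈-cartesianProductWith⁺ _∷_ (∈-allFin x) (allVecs-complete v))

  perms : ∀ n → List (Vec (Fin n) n)
  perms n = filter (λ v → UniqueDec.unique? _≟ᶠ_ (toList v)) (allVecs n n)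

  perms-unique : ∀ n → UP.Unique (perms n)
  perms-unique n = UPP.filter⁺ (λ v → UniqueDec.unique? _≟ᶠ_ (toList v)) (allVecs-unique n n)

  ∈-perms⁻ : ∀ {n} {v : Vec (Fin n) n} → v ∈ perms n → Distinct v
  ∈-perms⁻ {n} v∈ = proj₂ (∈-filter⁻ (λ v → UniqueDec.unique? _≟ᶠ_ (toList v)) {xs = allVecs n n} v∈)

  ∈-perms⁺ : ∀ {n} {v : Vec (Fin n) n} → Distinct v → v ∈ perms n
  ∈-perms⁺ {n} {v} dv = ∈-filter⁺ (λ v → UniqueDec.unique? _≟ᶠ_ (toList v)) (allVecs-complete v) dv

  asc : ∀ {m k} → Vec (Fin m) k → ℕ
  asc v = ascentsL (toList v)

  <ᵇ-true : ∀ {m n} → m < n → (m <ᵇ n) ≡ true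
  <ᵇ-true {m} {n} m<n with m <ᵇ n | ℕP.<⇒<ᵇ m<n
  ... | true | _ = refl

  <ᵇ-false : ∀ {m n} → n < m → (m <ᵇ n) ≡ false
  <ᵇ-false {m} {n} n<m with m <ᵇ n in eq
  ... | false = refl
  ... | true  = ⊥-elim (ℕP.<-asym n<m (ℕP.<ᵇ⇒< m n (subst T (sym eq) _)))

  asc-bound : ∀ {m k} (y : Fin m) (v : Vec (Fin m) k) → asc (y ∷ v) ≤ k
  asc-bound y []      = z≤n
  asc-bound y (z ∷ v) with toℕ y <ᵇ toℕ z
  ... | true  = s≤s (asc-bound z v)
  ... | false = m≤n⇒m≤1+n (asc-bound z v)

  Below : ∀ {m k} → Fin m → Vec (Fin m) k → Set
  Below M v = AllV.All (λ y → toℕ y < toℕ M) v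

  -- A gap inside one of the a = asc (x ∷ v) ascents keeps the
  -- ascent count; every other gap (inside a descent, or at the end) raises it
  -- by one.
  insert-above-after : ∀ {m k} (M x : Fin m) (v : Vec (Fin m) k) → toℕ x < toℕ M → Below M v →
    (f : ℕ → ℕ) → sumFin (λ i → f (asc (x ∷ insertAt v i M)))
       ≡ asc (x ∷ v) * f (asc (x ∷ v)) + (suc k ∸ asc (x ∷ v)) * f (suc (asc (x ∷ v)))
  insert-above-after M x [] x<M [] f rewrite <ᵇ-true x<M = refl
  insert-above-after {k = suc k} M x (y ∷ v) x<M (y<M ∷ v<M) f
    rewrite <ᵇ-true x<M | <ᵇ-false {toℕ M} {toℕ y} y<M with toℕ x <ᵇ toℕ y
  ... | true = begin
    f (suc a) + sumFin (λ i → f (suc (asc (y ∷ insertAt v i M))))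
      ≡⟨ cong (f (suc a) +_) (insert-above-after M y v y<M v<M (λ t → f (suc t))) ⟩
    f (suc a) + (a * f (suc a) + (suc k ∸ a) * f (suc (suc a)))
      ≡⟨ sym (+-assoc (f (suc a)) _ _) ⟩
    f (suc a) + a * f (suc a) + (suc k ∸ a) * f (suc (suc a)) ∎
    where a = asc (y ∷ v)
  ... | false = begin
    f (suc a) + sumFin (λ i → f (asc (y ∷ insertAt v i M)))
      ≡⟨ cong (f (suc a) +_) (insert-above-after M y v y<M v<M f) ⟩
    f (suc a) + (a * f a + (suc k ∸ a) * f (suc a))
      ≡⟨ shuffle (f (suc a)) (a * f a) (suc k ∸ a) ⟩
    a * f a + suc (suc k ∸ a) * f (suc a)
      ≡⟨ cong (λ z → a * f a + z * f (suc a)) (sym (ℕP.+-∸-assoc 1 (m≤n⇒m≤1+n (asc-bound y v)))) ⟩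
    a * f a + (suc (suc k) ∸ a) * f (suc a) ∎
    where a = asc (y ∷ v)
          shuffle : ∀ u w z → u + (w + z * u) ≡ w + (u + z * u)
          shuffle u w z = trans (sym (+-assoc u w _)) (trans (cong (_+ z * u) (+-comm u w)) (+-assoc w u _))

  -- The same with the front position allowed as well, which keeps the count:
  -- of the k + 1 positions, a + 1 keep the ascent count a = asc v and k - a
  -- raise it by one.
  insert-above : ∀ {m k} (M : Fin m) (v : Vec (Fin m) k) → Below M v →
    (f : ℕ → ℕ) → sumFin (λ i → f (asc (insertAt v i M)))
       ≡ suc (asc v) * f (asc v) + (k ∸ asc v) * f (suc (asc v))
  insert-above M []      []                f = sym (+-identityʳ _)
  insert-above {k = suc k} M (x ∷ v) (x<M ∷ v<M) f rewrite <ᵇ-false {toℕ M} {toℕ x} x<M = begin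
    f a + sumFin (λ i → f (asc (x ∷ insertAt v i M)))
      ≡⟨ cong (f a +_) (insert-above-after M x v x<M v<M f) ⟩
    f a + (a * f a + (suc k ∸ a) * f (suc a))
      ≡⟨ sym (+-assoc (f a) _ _) ⟩
    f a + a * f a + (suc k ∸ a) * f (suc a) ∎
    where a = asc (x ∷ v)

  insertMax : ∀ {n} → Vec (Fin n) n → Fin (suc n) → Vec (Fin (suc n)) (suc n)
  insertMax {n} u i = insertAt (Vec.map inject₁ u) i (fromℕ n)

  position-view : ∀ {k} (i a : Fin (suc k)) → a ≡ i ⊎ ∃ λ j → a ≡ punchIn i j
  position-view i a with a ≟ᶠ i
  ... | yes a≡i = inj₁ a≡i
  ... | no  a≢i = inj₂ (punchOut (λ i≡a → a≢i (sym i≡a)) , sym (FinP.punchIn-punchOut (λ i≡a → a≢i (sym i≡a))))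

  lookup-insertMax-at : ∀ {n} (u : Vec (Fin n) n) i → lookup (insertMax u i) i ≡ fromℕ n
  lookup-insertMax-at {n} u i = VecP.insertAt-lookup (Vec.map inject₁ u) i (fromℕ n)

  lookup-insertMax-off : ∀ {n} (u : Vec (Fin n) n) i j → lookup (insertMax u i) (punchIn i j) ≡ inject₁ (lookup u j)
  lookup-insertMax-off {n} u i j =
    trans (VecP.insertAt-punchIn (Vec.map inject₁ u) i (fromℕ n) j) (VecP.lookup-map j inject₁ u)

  map-inject₁-injective : ∀ {n k} (u u′ : Vec (Fin n) k) → Vec.map inject₁ u ≡ Vec.map inject₁ u′ → u ≡ u′
  map-inject₁-injective []      []        _  = refl
  map-inject₁-injective (x ∷ u) (y ∷ u′) eq =
    cong₂ _∷_ (FinP.inject₁-injective (VecP.∷-injectiveˡ eq)) (map-inject₁-injective u u′ (VecP.∷-injectiveʳ eq))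

  -- Different (u, i) give different insertions: compare where n sits, then remove it.
  insertMax-injective : ∀ {n} {u u′ : Vec (Fin n) n} {i i′} → insertMax u i ≡ insertMax u′ i′ → u ≡ u′ × i ≡ i′
  insertMax-injective {n} {u} {u′} {i} {i′} eq with position-view i′ i
  ... | inj₂ (j , refl) = ⊥-elim (FinP.fromℕ≢inject₁ (begin
    fromℕ n                                ≡⟨ sym (lookup-insertMax-at u (punchIn i′ j)) ⟩
    lookup (insertMax u (punchIn i′ j)) (punchIn i′ j) ≡⟨ cong (λ w → lookup w (punchIn i′ j)) eq ⟩
    lookup (insertMax u′ i′) (punchIn i′ j) ≡⟨ lookup-insertMax-off u′ i′ j ⟩
    inject₁ (lookup u′ j)                  ∎))
  ... | inj₁ refl = map-inject₁-injective u u′ (begin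
    Vec.map inject₁ u                 ≡⟨ sym (VecP.removeAt-insertAt (Vec.map inject₁ u) i (fromℕ n)) ⟩
    removeAt (insertMax u i) i        ≡⟨ cong (λ w → removeAt w i) eq ⟩
    removeAt (insertMax u′ i) i       ≡⟨ VecP.removeAt-insertAt (Vec.map inject₁ u′) i (fromℕ n) ⟩
    Vec.map inject₁ u′                ∎) , refl

  insertMax-perm : ∀ {n} (u : Vec (Fin n) n) i → LookupInjective u → LookupInjective (insertMax u i)
  insertMax-perm u i inj a b eq with position-view i a | position-view i b
  ... | inj₁ refl        | inj₁ refl         = refl
  ... | inj₁ refl        | inj₂ (j , refl)   = ⊥-elim (FinP.fromℕ≢inject₁
    (trans (sym (lookup-insertMax-at u i)) (trans eq (lookup-insertMax-off u i j))))
  ... | inj₂ (j , refl)  | inj₁ refl         = ⊥-elim (FinP.fromℕ≢inject₁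
    (trans (sym (lookup-insertMax-at u i)) (trans (sym eq) (lookup-insertMax-off u i j))))
  ... | inj₂ (j , refl)  | inj₂ (j′ , refl)  = cong (punchIn i) (inj j j′ (FinP.inject₁-injective
    (trans (sym (lookup-insertMax-off u i j)) (trans eq (lookup-insertMax-off u i j′)))))

  max-occurs : ∀ {n} (w : Vec (Fin (suc n)) (suc n)) → LookupInjective w → ∃ λ i → lookup w i ≡ fromℕ n
  max-occurs {n} w inj with FinP.any? (λ i → lookup w i ≟ᶠ fromℕ n)
  ... | yes found = found
  ... | no  absent = ⊥-elim (no-collision (FinP.pigeonhole (ℕP.n<1+n n) lowered))
    where
    ≢max : ∀ i → n ≢ toℕ (lookup w i)
    ≢max i eq = absent (i , FinP.toℕ-injective (trans (sym eq) (sym (FinP.toℕ-fromℕ n))))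
    lowered : Fin (suc n) → Fin n
    lowered i = lower₁ (lookup w i) (≢max i)
    no-collision : ¬ (∃₂ λ i j → i Fin.< j × lowered i ≡ lowered j)
    no-collision (i , j , i<j , eq) = ℕP.<-irrefl (cong toℕ (inj i j (FinP.lower₁-injective eq))) i<j

  removeMax : ∀ {n} (w : Vec (Fin (suc n)) (suc n)) → LookupInjective w →
    ∃₂ λ u i → LookupInjective u × w ≡ insertMax u i
  removeMax {n} w inj = u , i , u-injective , w≡
    where
    i = proj₁ (max-occurs w inj)
    w[i] = proj₂ (max-occurs w inj)
    r = removeAt w i
    lookup-r : ∀ j → lookup r j ≡ lookup w (punchIn i j)
    lookup-r j = trans (cong (lookup r) (sym (FinP.punchOut-punchIn i)))
                       (VecP.removeAt-punchOut w (λ eq → FinP.punchInᵢ≢i i j (sym eq)))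
    ≢max : ∀ j → n ≢ toℕ (lookup r j)
    ≢max j eq = FinP.punchInᵢ≢i i j (inj (punchIn i j) i
      (trans (sym (lookup-r j)) (trans (FinP.toℕ-injective (trans (sym eq) (sym (FinP.toℕ-fromℕ n)))) (sym w[i]))))
    u : Vec (Fin n) n
    u = tabulate (λ j → lower₁ (lookup r j) (≢max j))
    map-u : Vec.map inject₁ u ≡ r
    map-u = trans (sym (VecP.tabulate-∘ inject₁ (λ j → lower₁ (lookup r j) (≢max j))))
           (trans (VecP.tabulate-cong (λ j → FinP.inject₁-lower₁ (lookup r j) (≢max j))) (VecP.tabulate∘lookup r))
    lookup-u : ∀ j → lookup u j ≡ lower₁ (lookup r j) (≢max j)
    lookup-u j = VecP.lookup∘tabulate (λ j → lower₁ (lookup r j) (≢max j)) j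
    u-injective : LookupInjective u
    u-injective a b eq = FinP.punchIn-injective i a b (inj (punchIn i a) (punchIn i b)
       (trans (sym (lookup-r a)) (trans (FinP.lower₁-injective (trans (sym (lookup-u a)) (trans eq (lookup-u b)))) (lookup-r b))))
    w≡ : w ≡ insertMax u i
    w≡ = trans (sym (VecP.insertAt-removeAt w i)) (cong₂ (λ x y → insertAt x i y) (sym map-u) w[i])

  perms-suc : ∀ n → perms (suc n) ↭ cartesianProductWith insertMax (perms n) (allFin (suc n))
  perms-suc n = ∼bag⇒↭ (unique∧set⇒bag (perms-unique (suc n))
                  (UPP.cartesianProductWith⁺ insertMax insertMax-injective (perms-unique n) (UPP.allFin⁺ (suc n)))
                  (mk⇔ to from))
    where
    to : ∀ {w} → w ∈ perms (suc n) → w ∈ cartesianProductWith insertMax (perms n) (allFin (suc n))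
    to {w} w∈ with removeMax w (distinct⇒injective w (∈-perms⁻ w∈))
    ... | u , i , u-inj , refl = ∈-cartesianProductWith⁺ insertMax (∈-perms⁺ (injective⇒distinct u u-inj)) (∈-allFin i)
    from : ∀ {w} → w ∈ cartesianProductWith insertMax (perms n) (allFin (suc n)) → w ∈ perms (suc n)
    from {w} w∈ with ∈-cartesianProductWith⁻ insertMax (perms n) (allFin (suc n)) w∈
    ... | u , i , u∈ , _ , refl =
      ∈-perms⁺ (injective⇒distinct (insertMax u i) (insertMax-perm u i (distinct⇒injective u (∈-perms⁻ u∈))))

  asc-inject₁ : ∀ {n k} (u : Vec (Fin n) k) → asc (Vec.map inject₁ u) ≡ asc u
  asc-inject₁ u = trans (cong ascentsL (VecP.toList-map inject₁ u)) (go (toList u))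
    where
    go : ∀ {n} (l : List (Fin n)) → ascentsL (List.map inject₁ l) ≡ ascentsL l
    go []          = refl
    go (x ∷ [])    = refl
    go (x ∷ y ∷ l) = cong₂ _+_ (cong₂ (λ a b → if a <ᵇ b then 1 else 0) (FinP.toℕ-inject₁ x) (FinP.toℕ-inject₁ y)) (go (y ∷ l))

  below-max : ∀ {n k} (u : Vec (Fin n) k) → Below (fromℕ n) (Vec.map inject₁ u)
  below-max {n} u = AllVP.map⁺ (AllV.universal
    (λ y → subst₂ _<_ (sym (FinP.toℕ-inject₁ y)) (sym (FinP.toℕ-fromℕ n)) (FinP.toℕ<n y)) u)

  ascent-distribution : ∀ n (f : ℕ → ℕ) → sumOver (λ v → f (asc v)) (perms n) ≡ Σℕ.sum (suc n) (λ k → A n k * f k)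
  ascent-distribution zero    f = refl
  ascent-distribution (suc n) f = begin
    sumOver (λ v → f (asc v)) (perms (suc n))
      ≡⟨ sumOver-↭ (λ v → f (asc v)) (perms-suc n) ⟩
    sumOver (λ v → f (asc v)) (cartesianProductWith insertMax (perms n) (allFin (suc n)))
      ≡⟨ sumOver-product (λ v → f (asc v)) insertMax (perms n) ⟩
    sumOver (λ u → sumFin (λ i → f (asc (insertMax u i)))) (perms n)
      ≡⟨ sumOver-cong (perms n) insertions ⟩
    sumOver (λ u → g (asc u)) (perms n)
      ≡⟨ ascent-distribution n g ⟩
    Σℕ.sum (suc n) (λ k → A n k * g k)
      ≡⟨ sum-transfer n f ⟩
    Σℕ.sum (suc (suc n)) (λ k → A (suc n) k * f k) ∎
    where
    g : ℕ → ℕ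
    g a = suc a * f a + (n ∸ a) * f (suc a)
    insertions : ∀ u → sumFin (λ i → f (asc (insertMax u i))) ≡ g (asc u)
    insertions u = trans (insert-above (fromℕ n) (Vec.map inject₁ u) (below-max u) f)
                         (cong g (asc-inject₁ u))

  indicator : ∀ {P : Set} → Dec P → ℕ
  indicator d = if does d then 1 else 0

  length-filter-× : ∀ {X : Set} {P Q : X → Set} (P? : ∀ x → Dec (P x)) (Q? : ∀ x → Dec (Q x)) xs →
    length (filter (λ x → P? x ×-dec Q? x) xs) ≡ sumOver (λ x → indicator (Q? x)) (filter P? xs)
  length-filter-× P? Q? [] = refl
  length-filter-× P? Q? (x ∷ xs) with P? x
  ... | no  _ = length-filter-× P? Q? xs
  ... | yes _ with Q? x
  ...   | yes _ = cong suc (length-filter-× P? Q? xs)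
  ...   | no  _ = length-filter-× P? Q? xs

  isEven : ℕ → ℕ
  isEven a = indicator (a % 2 ≟ 0)

  N≡eulerian-sum : ∀ n → N n ≡ Σℕ.sum (suc n) (λ k → A n k * isEven k)
  N≡eulerian-sum n =
    trans (length-filter-× (λ v → UniqueDec.unique? _≟ᶠ_ (toList v)) (λ v → ascents v % 2 ≟ 0) (allVecs n n))
          (ascent-distribution n isEven)

module Σℤ = RangeSum ℤP.+-*-commutativeSemiring

module Congruence (m : ℤ) where
  open import Data.Integer using (_+_; _*_; _-_; -_; 0ℤ; -1ℤ)
  open import Data.Integer.Tactic.RingSolver using (solve-∀)
  open import Data.Nat.Properties using (m<n⇒m<1+n; n<1+n)
  open import Relation.Binary.Bundles using (Setoid)
  open import Relation.Binary.Structures using (IsEquivalence)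
  import Relation.Binary.Reasoning.Setoid as SetoidReasoning
  open import Relation.Binary.PropositionalEquality
  open ≡-Reasoning

  infix 4 _≋_
  record _≋_ (x y : ℤ) : Set where
    constructor _,_
    field
      quotient : ℤ
      equation : x - y ≡ quotient * m

  ≋-reflexive : ∀ {x y} → x ≡ y → x ≋ y
  ≋-reflexive {x} refl = 0ℤ , ℤP.+-inverseʳ x

  ≋-sym : ∀ {x y} → x ≋ y → y ≋ x
  ≋-sym {x} {y} (q , e) = (- q) , (begin
    y - x      ≡⟨ flip x y ⟩
    - (x - y)  ≡⟨ cong -_ e ⟩
    - (q * m)  ≡⟨ ℤP.neg-distribˡ-* q m ⟩
    - q * m    ∎)
    where flip : ∀ x y → y - x ≡ - (x - y)
          flip = solve-∀

  ≋-trans : ∀ {x y z} → x ≋ y → y ≋ z → x ≋ z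
  ≋-trans {x} {y} {z} (q , e) (q′ , e′) = (q + q′) , (begin
    x - z               ≡⟨ split x y z ⟩
    (x - y) + (y - z)   ≡⟨ cong₂ _+_ e e′ ⟩
    q * m + q′ * m      ≡⟨ sym (ℤP.*-distribʳ-+ m q q′) ⟩
    (q + q′) * m        ∎)
    where split : ∀ x y z → x - z ≡ (x - y) + (y - z)
          split = solve-∀

  ≋-isEquivalence : IsEquivalence _≋_
  ≋-isEquivalence = record { refl = ≋-reflexive refl ; sym = ≋-sym ; trans = ≋-trans }

  ≋-setoid : Setoid _ _
  ≋-setoid = record { isEquivalence = ≋-isEquivalence }

  module ≋-Reasoning = SetoidReasoning ≋-setoid

  ≋-+ : ∀ {x x′ y y′} → x ≋ x′ → y ≋ y′ → x + y ≋ x′ + y′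
  ≋-+ {x} {x′} {y} {y′} (q , e) (q′ , e′) = (q + q′) , (begin
    x + y - (x′ + y′)       ≡⟨ regroup x x′ y y′ ⟩
    (x - x′) + (y - y′)     ≡⟨ cong₂ _+_ e e′ ⟩
    q * m + q′ * m          ≡⟨ sym (ℤP.*-distribʳ-+ m q q′) ⟩
    (q + q′) * m            ∎)
    where regroup : ∀ x x′ y y′ → x + y - (x′ + y′) ≡ (x - x′) + (y - y′)
          regroup = solve-∀

  ≋-*ˡ : ∀ c {x y} → x ≋ y → c * x ≋ c * y
  ≋-*ˡ c {x} {y} (q , e) = (c * q) , (begin
    c * x - c * y  ≡⟨ factor c x y ⟩
    c * (x - y)    ≡⟨ cong (c *_) e ⟩
    c * (q * m)    ≡⟨ sym (ℤP.*-assoc c q m) ⟩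
    c * q * m      ∎)
    where factor : ∀ c x y → c * x - c * y ≡ c * (x - y)
          factor = solve-∀

  ≋-neg : ∀ {x y} → x ≋ y → - x ≋ - y
  ≋-neg {x} {y} e = subst₂ _≋_ (ℤP.-1*i≡-i x) (ℤP.-1*i≡-i y) (≋-*ˡ -1ℤ e)

  ≋-multiple : ∀ x q → x + q * m ≋ x
  ≋-multiple x q = q , cancel q m x
    where cancel : ∀ q m x → x + q * m - x ≡ q * m
          cancel = solve-∀

  sum-≋ : ∀ L {f g} → (∀ k → k < L → f k ≋ g k) → Σℤ.sum L f ≋ Σℤ.sum L g
  sum-≋ zero    _   = ≋-reflexive refl
  sum-≋ (suc L) f≋g = ≋-+ (sum-≋ L (λ k k<L → f≋g k (m<n⇒m<1+n k<L))) (f≋g L (n<1+n L))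

-- Fermat's little theorem for a prime p = m + 1, from the binomial theorem:
-- p divides (p choose i) for 0 < i < p, so (a + 1)^p ≡ a^p + 1.
module Fermat {m : ℕ} (prime : Prime (suc m)) where
  open import Data.Nat using (_+_; _*_; _^_; _!; s≤s; z≤n; pred; >-nonZero)
  open import Data.Nat.Properties
  open import Data.Nat.Divisibility using (_∣_; divides; ∣⇒≤; ∣1⇒≡1; ∣m∣n⇒∣m+n; ∣m⇒∣m*n)
  open import Data.Nat.Primality using (euclidsLemma; prime⇒irreducible; ¬prime[1])
  open import Data.Nat.Coprimality using (Coprime)
  open import Data.Nat.Tactic.RingSolver using (solve-∀)
  open import Data.Product using (∃; _,_; proj₁; proj₂)
  open import Data.Sum using (_⊎_; inj₁; inj₂)
  open import Data.Empty using (⊥-elim)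
  open import Relation.Nullary using (¬_)
  open import Relation.Binary.PropositionalEquality
  open ≡-Reasoning
  open Σℕ using (sum; sum-shift)
  open Binomial using (C; C-diag; absorb; binomial-theorem)

  p : ℕ
  p = suc m

  ∤-between : ∀ a → 0 < a → a < p → ¬ (p ∣ a)
  ∤-between (suc a) _ a<p p∣a = <⇒≱ a<p (∣⇒≤ p∣a)

  ∤-factorial : ∀ k → k < p → ¬ (p ∣ k !)
  ∤-factorial zero    _   p∣1  = ¬prime[1] (subst Prime (∣1⇒≡1 p∣1) prime)
  ∤-factorial (suc k) k<p p∣k! with euclidsLemma (suc k) (k !) prime p∣k!
  ... | inj₁ p∣k+1 = ∤-between (suc k) (s≤s z≤n) k<p p∣k+1
  ... | inj₂ p∣k!′ = ∤-factorial k (<-trans (n<1+n k) k<p) p∣k!′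

  ∤⇒coprime : ∀ {a} → ¬ (p ∣ a) → Coprime a p
  ∤⇒coprime p∤a (d∣a , d∣p) with prime⇒irreducible prime d∣p
  ... | inj₁ d≡1 = d≡1
  ... | inj₂ refl = ⊥-elim (p∤a d∣a)

  ∣-sum : ∀ {d} L h → (∀ k → k < L → d ∣ h k) → d ∣ sum L h
  ∣-sum zero    h _   = divides 0 refl
  ∣-sum (suc L) h d∣h = ∣m∣n⇒∣m+n (∣-sum L h (λ k k<L → d∣h k (m<n⇒m<1+n k<L))) (d∣h L (n<1+n L))

  -- p ∣ (p choose i + 1) for i + 1 < p, since (i + 1) (p choose i + 1) = p (m choose i).
  p∣C : ∀ i → i < m → p ∣ C p (suc i)
  p∣C i i<m with euclidsLemma (suc i) (C p (suc i)) prime (divides (C m i) (trans (absorb m i) (*-comm p (C m i))))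
  ... | inj₁ p∣i+1 = ⊥-elim (∤-between (suc i) (s≤s z≤n) (s≤s i<m) p∣i+1)
  ... | inj₂ p∣C   = p∣C

  frobenius : ∀ a → ∃ λ Y → a ^ p ≡ a + Y * p
  frobenius zero    = 0 , refl
  frobenius (suc a) = (X + Y) , (begin
    suc a ^ p                                      ≡⟨ binomial-theorem a p ⟩
    sum p (λ i → C p i * a ^ i) + C p p * a ^ p    ≡⟨ cong₂ _+_ (sum-shift m (λ i → C p i * a ^ i)) (cong (_* a ^ p) (C-diag p)) ⟩
    1 * 1 + sum m middle + 1 * a ^ p               ≡⟨ cong₂ (λ u v → 1 * 1 + u + 1 * v) (_∣_.equality p∣middle) (proj₂ (frobenius a)) ⟩
    1 * 1 + X * p + 1 * (a + Y * p)                ≡⟨ collect a X Y p ⟩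
    suc a + (X + Y) * p                            ∎)
    where
    middle : ℕ → ℕ
    middle i = C p (suc i) * a ^ suc i
    p∣middle : p ∣ sum m middle
    p∣middle = ∣-sum m middle (λ i i<m → ∣m⇒∣m*n (a ^ suc i) (p∣C i i<m))
    X = _∣_.quotient p∣middle
    Y = proj₁ (frobenius a)
    collect : ∀ a X Y p → 1 * 1 + X * p + 1 * (a + Y * p) ≡ suc a + (X + Y) * p
    collect = solve-∀

  fermat : ∀ a → ¬ (p ∣ a) → ∃ λ Z → a ^ m ≡ 1 + Z * p
  fermat zero    p∤a = ⊥-elim (p∤a (divides 0 refl))
  fermat (suc a) p∤a = conclude (euclidsLemma (suc a) t prime (divides Y a·t≡Y·p))
    where
    Y = proj₁ (frobenius (suc a))
    t = pred (suc a ^ m)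
    power≡ : suc a ^ m ≡ suc t
    power≡ = sym (suc-pred (suc a ^ m) {{>-nonZero (m^n>0 (suc a) m)}})
    a·t≡Y·p : suc a * t ≡ Y * p
    a·t≡Y·p = +-cancelˡ-≡ (suc a) _ _ (begin
      suc a + suc a * t  ≡⟨ sym (*-suc (suc a) t) ⟩
      suc a * suc t      ≡⟨ cong (suc a *_) (sym power≡) ⟩
      suc a ^ p          ≡⟨ proj₂ (frobenius (suc a)) ⟩
      suc a + Y * p      ∎)
    conclude : p ∣ suc a ⊎ p ∣ t → ∃ λ Z → suc a ^ m ≡ 1 + Z * p
    conclude (inj₁ p∣a)               = ⊥-elim (p∤a p∣a)
    conclude (inj₂ (divides Z t≡Z·p)) = Z , trans power≡ (cong suc t≡Z·p)

module SummationByParts where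
  open import Data.Integer using (_+_; _*_; _-_; -_; +_; 0ℤ; 1ℤ)
  open import Data.Integer.Tactic.RingSolver using (solve-∀)
  open import Relation.Binary.PropositionalEquality
  open ≡-Reasoning
  open Σℤ using (sum; sum-cong; sum-+)

  sign : ℕ → ℤ
  sign zero    = 1ℤ
  sign (suc m) = - sign m

  Δ : (ℕ → ℤ) → ℕ → ℤ
  Δ a zero    = a 0
  Δ a (suc m) = a (suc m) - a m

  sum-Δ : ∀ a L → sum (suc L) (Δ a) ≡ a L
  sum-Δ a zero    = ℤP.+-identityˡ (a 0)
  sum-Δ a (suc L) = trans (cong (_+ (a (suc L) - a L)) (sum-Δ a L)) (cancel (a L) (a (suc L)))
    where cancel : ∀ x y → x + (y - x) ≡ y
          cancel = solve-∀

  alternating-sum-Δ : ∀ a L →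
    sum (suc L) (λ m → sign m * Δ a m) ≡ + 2 * sum (suc L) (λ m → sign m * a m) - sign L * a L
  alternating-sum-Δ a zero    = base (a 0)
    where base : ∀ x → 0ℤ + 1ℤ * x ≡ + 2 * (0ℤ + 1ℤ * x) - 1ℤ * x
          base = solve-∀
  alternating-sum-Δ a (suc L) =
    trans (cong (_+ (- sign L * (a (suc L) - a L))) (alternating-sum-Δ a L))
          (step (sum (suc L) (λ m → sign m * a m)) (sign L) (a L) (a (suc L)))
    where step : ∀ S s x y → + 2 * S - s * x + (- s * (y - x)) ≡ + 2 * (S + - s * y) - - s * y
          step = solve-∀

  weighted-sum-Δ : ∀ a L → sum L (λ m → (+ L - + m) * Δ a m) ≡ sum L a
  weighted-sum-Δ a zero    = refl
  weighted-sum-Δ a (suc L) = begin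
    sum L (λ m → (+ suc L - + m) * Δ a m) + (+ suc L - + L) * Δ a L
      ≡⟨ cong₂ _+_ (trans (sum-cong L (λ m _ → peel (+ L) (+ m) (Δ a m))) (sum-+ L _ _)) (last (+ L) (Δ a L)) ⟩
    (sum L (λ m → (+ L - + m) * Δ a m) + sum L (Δ a)) + Δ a L
      ≡⟨ cong (λ z → (z + sum L (Δ a)) + Δ a L) (weighted-sum-Δ a L) ⟩
    (sum L a + sum L (Δ a)) + Δ a L
      ≡⟨ ℤP.+-assoc (sum L a) _ _ ⟩
    sum L a + sum (suc L) (Δ a)
      ≡⟨ cong (λ z → sum L a + z) (sum-Δ a L) ⟩
    sum L a + a L ∎
    where peel : ∀ x y d → (1ℤ + x - y) * d ≡ (x - y) * d + d
          peel = solve-∀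
          last : ∀ x d → (1ℤ + x - x) * d ≡ d
          last = solve-∀

-- 2 N_n = Σ_k A(n,k) + Σ_k (-1)^k A(n,k), because 2 [k even] = 1 + (-1)^k.
module EvenAscentCount where
  open import Data.Nat using (_%_; _≟_)
  open import Data.Nat.DivMod using ([m+n]%n≡m%n)
  open import Data.Integer using (+_; _+_; _*_; 1ℤ)
  open import Data.Integer.Tactic.RingSolver using (solve-∀)
  open import Relation.Binary.PropositionalEquality
  open ≡-Reasoning
  open Σℤ using (sum; sum-cong; sum-+; sum-*ˡ)
  open Eulerian using (A)
  open Permutations using (indicator; isEven; N≡eulerian-sum)
  open SummationByParts using (sign)

  +-sum : ∀ L f → + (Σℕ.sum L f) ≡ sum L (λ k → + f k)
  +-sum zero    f = refl
  +-sum (suc L) f = trans (ℤP.pos-+ (Σℕ.sum L f) (f L)) (cong (_+ + f L) (+-sum L f))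

  twice-isEven : ∀ k → + 2 * + isEven k ≡ 1ℤ + sign k
  twice-isEven zero          = refl
  twice-isEven (suc zero)    = refl
  twice-isEven (suc (suc k)) = begin
    + 2 * + isEven (suc (suc k))         ≡⟨ cong (λ r → + 2 * + indicator (r ≟ 0)) (trans (cong (_% 2) (ℕP.+-comm 2 k)) ([m+n]%n≡m%n k 2)) ⟩
    + 2 * + isEven k                    ≡⟨ twice-isEven k ⟩
    1ℤ + sign k                         ≡⟨ cong (λ z → 1ℤ + z) (sym (ℤP.neg-involutive (sign k))) ⟩
    1ℤ + sign (suc (suc k))             ∎

  twice-N : ∀ n → + 2 * + N n ≡ sum (suc n) (λ k → + A n k) + sum (suc n) (λ k → sign k * + A n k)
  twice-N n = begin
    + 2 * + N n
      ≡⟨ cong (λ z → + 2 * z) (trans (cong +_ (N≡eulerian-sum n)) (trans (+-sum (suc n) _) (sum-cong (suc n) (λ k _ → ℤP.pos-* (A n k) (isEven k))))) ⟩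
    + 2 * sum (suc n) (λ k → + A n k * + isEven k)
      ≡⟨ sym (sum-*ˡ (suc n) (+ 2) _) ⟩
    sum (suc n) (λ k → + 2 * (+ A n k * + isEven k))
      ≡⟨ sum-cong (suc n) (λ k _ → trans (commute (+ A n k) (+ isEven k)) (cong (+ A n k *_) (twice-isEven k))) ⟩
    sum (suc n) (λ k → + A n k * (1ℤ + sign k))
      ≡⟨ sum-cong (suc n) (λ k _ → expand (+ A n k) (sign k)) ⟩
    sum (suc n) (λ k → + A n k + sign k * + A n k)
      ≡⟨ sum-+ (suc n) _ _ ⟩
    sum (suc n) (λ k → + A n k) + sum (suc n) (λ k → sign k * + A n k) ∎
    where commute : ∀ a e → + 2 * (a * e) ≡ a * (+ 2 * e)
          commute = solve-∀
          expand : ∀ a s → a * (1ℤ + s) ≡ a + s * a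
          expand = solve-∀

module WorpitzkyModPrime (n : ℕ) (prime : Prime (suc (suc n))) (n≥1 : 1 ≤ n) where
  open import Data.Nat using (_+_; _*_; _∸_; _^_; s≤s; z≤n)
  open import Data.Nat.Properties
  open import Data.Nat.Divisibility using (_∣_; divides; ∣n⇒∣m*n)
  open import Data.Nat.Primality using (euclidsLemma)
  open import Data.Product using (∃; _,_)
  open import Data.Sum using (inj₁; inj₂)
  open import Data.Empty using (⊥-elim)
  open import Relation.Binary.PropositionalEquality
  open ≡-Reasoning
  open Σℕ using (sum)
  open Binomial using (B; B-1; B-stepˡ)
  open Eulerian using (A; worpitzky)
  open Fermat prime using (p; ∤-between; ∣-sum)

  -- p ∣ (n + a choose a) for 2 ≤ a ≤ n + 1, since then p ≤ n + a < 2p.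
  p∣B : ∀ l → suc l ≤ n → p ∣ B n (suc (suc l))
  p∣B zero _ with euclidsLemma 2 (B n 2) prime
                    (divides (B n 1) (trans (B-stepˡ n 1) (trans (cong (λ z → suc z * B n 1) (+-comm n 1)) (*-comm p (B n 1)))))
  ... | inj₁ p∣2 = ⊥-elim (∤-between 2 (s≤s z≤n) (s≤s (s≤s n≥1)) p∣2)
  ... | inj₂ p∣B = p∣B
  p∣B (suc l) l+2≤n with euclidsLemma (suc (suc (suc l))) (B n (suc (suc (suc l)))) prime
    (subst (p ∣_) (sym (B-stepˡ n (suc (suc l)))) (∣n⇒∣m*n (suc (n + suc (suc l))) (p∣B l (≤-trans (n≤1+n (suc l)) l+2≤n))))
  ... | inj₁ p∣l+3 = ⊥-elim (∤-between (suc (suc (suc l))) (s≤s z≤n) (s≤s (s≤s l+2≤n)) p∣l+3)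
  ... | inj₂ p∣B   = p∣B

  -- Worpitzky's identity modulo p: for j = m + 1 ≤ n only the terms k = m and
  -- k = m + 1 survive, giving (m + 2)^n ≡ (n + 1) A(n,m) + A(n,m+1).
  worpitzky-mod-p : ∀ m → suc m ≤ n → ∃ λ X → suc (suc m) ^ n ≡ X * p + A n m * suc n + A n (suc m)
  worpitzky-mod-p m m+1≤n = X , (begin
    suc (suc m) ^ n                                       ≡⟨ sym (worpitzky n (suc m)) ⟩
    sum m h + h m + h (suc m)                             ≡⟨ cong₂ (λ u v → u + A n m * B n v + A n (suc m) * B n (m ∸ m)) (_∣_.equality p∣low) (m+n∸n≡m 1 m) ⟩
    X * p + A n m * B n 1 + A n (suc m) * B n (m ∸ m)     ≡⟨ cong₂ (λ u v → X * p + A n m * u + A n (suc m) * B n v) (B-1 n) (n∸n≡0 m) ⟩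
    X * p + A n m * suc n + A n (suc m) * 1               ≡⟨ cong (X * p + A n m * suc n +_) (*-identityʳ (A n (suc m))) ⟩
    X * p + A n m * suc n + A n (suc m)                   ∎)
    where
    h : ℕ → ℕ
    h k = A n k * B n (suc m ∸ k)
    low-term : ∀ k → k < m → p ∣ h k
    low-term k k<m = ∣n⇒∣m*n (A n k) (subst (λ z → p ∣ B n z) (sym m+1-k≡) (p∣B (m ∸ suc k) bound))
      where
      m-k≡ : m ∸ k ≡ suc (m ∸ suc k)
      m-k≡ = +-∸-assoc 1 k<m
      m+1-k≡ : suc m ∸ k ≡ suc (suc (m ∸ suc k))
      m+1-k≡ = trans (+-∸-assoc 1 (<⇒≤ k<m)) (cong suc m-k≡)
      bound : suc (m ∸ suc k) ≤ n
      bound = subst (_≤ n) m-k≡ (≤-trans (m∸n≤m m k) (≤-trans (n≤1+n m) m+1≤n))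
    p∣low : p ∣ sum m h
    p∣low = ∣-sum m h low-term
    X = _∣_.quotient p∣low

module Rationals where
  open import Data.Nat as ℕ using (_!)
  open import Data.Nat.Divisibility using (_∣_; divides)
  open import Data.Nat.Coprimality using (coprime-divisor; recompute) renaming (sym to coprime-sym)
  open import Data.Integer as ℤ using (+_; -1ℤ)
  open import Data.Integer.Tactic.RingSolver using (solve-∀)
  open import Data.Integer.GCD using (gcd)
  open import Data.Rational as ℚ using (ℚ; _/_; ↥_; ↧_; ↧ₙ_; toℚᵘ; mkℚ)
  import Data.Rational.Properties as ℚP
  open import Data.Rational.Unnormalised as ℚᵘ using (mkℚᵘ; *≡*)
  import Data.Rational.Unnormalised.Properties as ℚᵘP
  open import Data.Rational.Solver using (module +-*-Solver)
  open +-*-Solver using (solve; _:+_; _:*_; _:=_)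
  open import Relation.Binary.PropositionalEquality
  open ≡-Reasoning
  open SummationByParts using (sign)

  ι : ℤ → ℚ
  ι i = i / 1

  toℚᵘ-/ : ∀ i d → toℚᵘ (i / suc d) ℚᵘ.≃ mkℚᵘ i d
  toℚᵘ-/ i d = *≡* (begin
    ℚᵘ.↥ toℚᵘ x ℤ.* + suc d  ≡⟨ cong (ℤ._* + suc d) (ℚP.↥ᵘ-toℚᵘ x) ⟩
    ↥ x ℤ.* + suc d          ≡⟨ cong (↥ x ℤ.*_) (sym (ℚP.↧-/ i (suc d))) ⟩
    ↥ x ℤ.* (↧ x ℤ.* g)      ≡⟨ swap (↥ x) (↧ x) g ⟩
    ↥ x ℤ.* g ℤ.* ↧ x        ≡⟨ cong (ℤ._* ↧ x) (ℚP.↥-/ i (suc d)) ⟩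
    i ℤ.* ↧ x                ≡⟨ cong (i ℤ.*_) (sym (ℚP.↧ᵘ-toℚᵘ x)) ⟩
    i ℤ.* ℚᵘ.↧ toℚᵘ x        ∎)
    where
    x = i / suc d
    g = gcd i (+ suc d)
    swap : ∀ a b g → a ℤ.* (b ℤ.* g) ≡ a ℤ.* g ℤ.* b
    swap = solve-∀

  ι-+ : ∀ i j → ι i ℚ.+ ι j ≡ ι (i ℤ.+ j)
  ι-+ i j = ℚP.toℚᵘ-injective (ℚᵘP.≃-trans (ℚP.toℚᵘ-homo-+ (ι i) (ι j))
     (ℚᵘP.≃-trans (ℚᵘP.+-cong (toℚᵘ-/ i 0) (toℚᵘ-/ j 0))
     (ℚᵘP.≃-trans (*≡* (normalise i j)) (ℚᵘP.≃-sym (toℚᵘ-/ (i ℤ.+ j) 0)))))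
    where normalise : ∀ i j → (i ℤ.* + 1 ℤ.+ j ℤ.* + 1) ℤ.* + 1 ≡ (i ℤ.+ j) ℤ.* + 1
          normalise = solve-∀

  ι-* : ∀ i j → ι i ℚ.* ι j ≡ ι (i ℤ.* j)
  ι-* i j = ℚP.toℚᵘ-injective (ℚᵘP.≃-trans (ℚP.toℚᵘ-homo-* (ι i) (ι j))
     (ℚᵘP.≃-trans (ℚᵘP.*-cong (toℚᵘ-/ i 0) (toℚᵘ-/ j 0))
     (ℚᵘP.≃-trans (*≡* refl) (ℚᵘP.≃-sym (toℚᵘ-/ (i ℤ.* j) 0)))))

  ι-neg : ∀ i → ℚ.- ι i ≡ ι (ℤ.- i)
  ι-neg i = ℚP.toℚᵘ-injective (ℚᵘP.≃-trans (ℚP.toℚᵘ-homo‿- (ι i))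
     (ℚᵘP.≃-trans (ℚᵘP.-‿cong (toℚᵘ-/ i 0)) (ℚᵘP.≃-sym (toℚᵘ-/ (ℤ.- i) 0))))

  ι-- : ∀ i j → ι i ℚ.- ι j ≡ ι (i ℤ.- j)
  ι-- i j = trans (cong (ι i ℚ.+_) (ι-neg j)) (ι-+ i (ℤ.- j))

  /-cancel : ∀ i m → (i / suc m) ℚ.* ι (+ suc m) ≡ ι i
  /-cancel i m = ℚP.toℚᵘ-injective (ℚᵘP.≃-trans (ℚP.toℚᵘ-homo-* (i / suc m) (ι (+ suc m)))
     (ℚᵘP.≃-trans (ℚᵘP.*-cong (toℚᵘ-/ i m) (toℚᵘ-/ (+ suc m) 0))
     (ℚᵘP.≃-trans (*≡* cross) (ℚᵘP.≃-sym (toℚᵘ-/ i 0)))))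
    where
    cross : i ℤ.* + suc m ℤ.* + 1 ≡ i ℤ.* + suc (m ℕ.* 1)
    cross = trans (ℤP.*-identityʳ _) (cong (λ t → i ℤ.* + suc t) (sym (ℕP.*-identityʳ m)))

  ι·reciprocal : ∀ m → ι (+ suc m) ℚ.* (+ 1 / suc m) ≡ ℚ.1ℚ
  ι·reciprocal m = ℚP.toℚᵘ-injective (ℚᵘP.≃-trans (ℚP.toℚᵘ-homo-* (ι (+ suc m)) (+ 1 / suc m))
     (ℚᵘP.≃-trans (ℚᵘP.*-cong (toℚᵘ-/ (+ suc m) 0) (toℚᵘ-/ (+ 1) m)) (*≡* cross)))
    where
    cross : + suc m ℤ.* + 1 ℤ.* + 1 ≡ + 1 ℤ.* + suc (m ℕ.+ 0)
    cross = trans (ℤP.*-identityʳ _) (trans (ℤP.*-identityʳ _)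
              (trans (cong (λ t → + suc t) (sym (ℕP.+-identityʳ m))) (sym (ℤP.*-identityˡ _))))

  sign≡-1^ : ∀ k → -1ℤ ℤ.^ k ≡ sign k
  sign≡-1^ zero    = refl
  sign≡-1^ (suc k) = trans (cong (-1ℤ ℤ.*_) (sign≡-1^ k)) (ℤP.-1*i≡-i (sign k))

  -- scaledHarmonic m = m! Σ_{k=1}^m (-1)^k / k, an integer.
  scaledHarmonic : ℕ → ℤ
  scaledHarmonic zero    = + 0
  scaledHarmonic (suc m) = + suc m ℤ.* scaledHarmonic m ℤ.+ sign (suc m) ℤ.* + (m !)

  altHarmonic-scaled : ∀ m → altHarmonic m ℚ.* ι (+ (m !)) ≡ ι (scaledHarmonic m)
  altHarmonic-scaled zero    = ℚP.*-zeroˡ (ι (+ 1))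
  altHarmonic-scaled (suc m) = begin
    (h ℚ.+ t) ℚ.* ι (+ (suc m ℕ.* m !))
      ≡⟨ cong (λ z → (h ℚ.+ t) ℚ.* ι z) (ℤP.pos-* (suc m) (m !)) ⟩
    (h ℚ.+ t) ℚ.* ι (+ suc m ℤ.* + (m !))
      ≡⟨ cong ((h ℚ.+ t) ℚ.*_) (sym (ι-* (+ suc m) (+ (m !)))) ⟩
    (h ℚ.+ t) ℚ.* (ι (+ suc m) ℚ.* ι (+ (m !)))
      ≡⟨ solve 4 (λ a t k f → (a :+ t) :* (k :* f) := (a :* f) :* k :+ (t :* k) :* f) refl h t (ι (+ suc m)) (ι (+ (m !))) ⟩
    (h ℚ.* ι (+ (m !))) ℚ.* ι (+ suc m) ℚ.+ (t ℚ.* ι (+ suc m)) ℚ.* ι (+ (m !))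
      ≡⟨ cong₂ (λ u v → u ℚ.* ι (+ suc m) ℚ.+ v ℚ.* ι (+ (m !))) (altHarmonic-scaled m) (/-cancel s m) ⟩
    ι (scaledHarmonic m) ℚ.* ι (+ suc m) ℚ.+ ι s ℚ.* ι (+ (m !))
      ≡⟨ cong₂ ℚ._+_ (ι-* (scaledHarmonic m) (+ suc m)) (ι-* s (+ (m !))) ⟩
    ι (scaledHarmonic m ℤ.* + suc m) ℚ.+ ι (s ℤ.* + (m !))
      ≡⟨ ι-+ (scaledHarmonic m ℤ.* + suc m) (s ℤ.* + (m !)) ⟩
    ι (scaledHarmonic m ℤ.* + suc m ℤ.+ s ℤ.* + (m !))
      ≡⟨ cong ι (cong₂ ℤ._+_ (ℤP.*-comm (scaledHarmonic m) (+ suc m)) (cong (ℤ._* + (m !)) (sign≡-1^ (suc m)))) ⟩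
    ι (scaledHarmonic (suc m)) ∎
    where
    h = altHarmonic m
    s = -1ℤ ℤ.^ suc m
    t = s / suc m

  -- If c · F is an integer w then the denominator of c divides F: from
  -- num · F = w · den and gcd(num, den) = 1.
  denominator-∣ᵘ : ∀ (c : ℚ) (F : ℕ) (w : ℤ) → toℚᵘ c ℚᵘ.* mkℚᵘ (+ F) 0 ℚᵘ.≃ mkℚᵘ w 0 → ↧ₙ c ∣ F
  denominator-∣ᵘ (mkℚ num den coprime) F w (*≡* cross) =
    coprime-divisor (coprime-sym (recompute coprime)) (divides ℤ.∣ w ∣ (begin
      ℤ.∣ num ∣ ℕ.* F                   ≡⟨ sym (ℕP.*-identityʳ _) ⟩
      ℤ.∣ num ∣ ℕ.* F ℕ.* 1             ≡⟨ cong (ℕ._* 1) (sym (ℤP.abs-* num (+ F))) ⟩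
      ℤ.∣ num ℤ.* + F ∣ ℕ.* 1           ≡⟨ sym (ℤP.abs-* (num ℤ.* + F) (+ 1)) ⟩
      ℤ.∣ num ℤ.* + F ℤ.* + 1 ∣         ≡⟨ cong ℤ.∣_∣ cross ⟩
      ℤ.∣ w ℤ.* + suc (den ℕ.* 1) ∣     ≡⟨ ℤP.abs-* w _ ⟩
      ℤ.∣ w ∣ ℕ.* suc (den ℕ.* 1)       ≡⟨ cong (λ z → ℤ.∣ w ∣ ℕ.* suc z) (ℕP.*-identityʳ den) ⟩
      ℤ.∣ w ∣ ℕ.* suc den               ∎))

  denominator-∣ : ∀ (c : ℚ) (F : ℕ) (w : ℤ) → c ℚ.* ι (+ F) ≡ ι w → ↧ₙ c ∣ F
  denominator-∣ c F w c·F≡w = denominator-∣ᵘ c F w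
    (ℚᵘP.≃-trans (ℚᵘP.≃-sym (ℚᵘP.*-cong (ℚᵘP.≃-refl {toℚᵘ c}) (toℚᵘ-/ (+ F) 0)))
    (ℚᵘP.≃-trans (ℚᵘP.≃-sym (ℚP.toℚᵘ-homo-* c (ι (+ F))))
    (ℚᵘP.≃-trans (ℚᵘP.≃-reflexive (cong toℚᵘ c·F≡w)) (toℚᵘ-/ w 0))))

-- Write q = p - 1 and
-- a(m) = A(n,m); then modulo p
--   Δa(m) ≡ (m+1)^n ≡ 1/(m+1)        (Worpitzky, Fermat),
--   Σ_{m<q} a(m) = Σ (q-m) Δa(m) ≡ Σ -1 = -q ≡ 1,
--   2 Σ (-1)^m a(m) = Σ (-1)^m Δa(m) ≡ Σ_{m<q} (-1)^m/(m+1),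
-- and 2N = Σ a(m) + Σ (-1)^m a(m) finishes the computation.
module HarmonicModPrime (n : ℕ) (prime : Prime (suc (suc n))) (n≥1 : 1 ≤ n) where
  open import Data.Nat as ℕ using (_^_; _!; s≤s; z≤n)
  open import Data.Integer using (+_; _+_; _*_; _-_; -_; 1ℤ; -1ℤ)
  open import Data.Integer.Tactic.RingSolver using (solve-∀)
  open import Data.Product using (proj₁; proj₂)
  open import Relation.Binary.PropositionalEquality
  open Σℤ using (sum; sum-cong; sum-*ˡ)
  open Eulerian using (A; A-0; A-diag)
  open Fermat prime using (p; ∤-between; fermat)
  open WorpitzkyModPrime n prime n≥1 using (worpitzky-mod-p)
  open SummationByParts using (sign; Δ; alternating-sum-Δ; weighted-sum-Δ)
  open EvenAscentCount using (twice-N)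
  open Rationals using (scaledHarmonic)
  open Congruence (+ p)
  open ≋-Reasoning

  q : ℕ
  q = suc n

  a power : ℕ → ℤ
  a     m = + A n m
  power m = + (suc m ^ n)

  p≡1+q : + p ≡ 1ℤ + + q
  p≡1+q = ℤP.pos-+ 1 q

  power-inverse : ∀ m → m ≤ n → + suc m * power m ≋ 1ℤ
  power-inverse m m≤n = begin
    + suc m * power m      ≡⟨ sym (ℤP.pos-* (suc m) (suc m ^ n)) ⟩
    + (suc m ^ suc n)      ≡⟨ cong +_ (proj₂ little) ⟩
    + (1 ℕ.+ Z ℕ.* p)      ≡⟨ trans (ℤP.pos-+ 1 (Z ℕ.* p)) (cong (λ t → 1ℤ + t) (ℤP.pos-* Z p)) ⟩
    1ℤ + + Z * + p         ≈⟨ ≋-multiple 1ℤ (+ Z) ⟩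
    1ℤ                     ∎
    where
    little = fermat (suc m) (∤-between (suc m) (s≤s z≤n) (s≤s (s≤s m≤n)))
    Z = proj₁ little

  Δa≋power : ∀ m → m ≤ n → Δ a m ≋ power m
  Δa≋power zero    _      = ≋-reflexive (cong +_ (trans (A-0 n) (sym (ℕP.^-zeroˡ n))))
  Δa≋power (suc m) m+1≤n = ≋-sym (begin
    power (suc m)                              ≡⟨ cong +_ (proj₂ (worpitzky-mod-p m m+1≤n)) ⟩
    + (X ℕ.* p ℕ.+ A n m ℕ.* q ℕ.+ A n (suc m)) ≡⟨ embed ⟩
    + X * + p + a m * + q + a (suc m)          ≡⟨ cong (λ t → + X * t + a m * + q + a (suc m)) p≡1+q ⟩
    + X * (1ℤ + + q) + a m * + q + a (suc m)   ≡⟨ regroup (+ X) (a m) (a (suc m)) (+ q) ⟩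
    a (suc m) - a m + (+ X + a m) * (1ℤ + + q) ≡⟨ cong (λ t → a (suc m) - a m + (+ X + a m) * t) (sym p≡1+q) ⟩
    Δ a (suc m) + (+ X + a m) * + p            ≈⟨ ≋-multiple (Δ a (suc m)) (+ X + a m) ⟩
    Δ a (suc m)                                ∎)
    where
    X = proj₁ (worpitzky-mod-p m m+1≤n)
    embed : + (X ℕ.* p ℕ.+ A n m ℕ.* q ℕ.+ A n (suc m)) ≡ + X * + p + a m * + q + a (suc m)
    embed = trans (ℤP.pos-+ (X ℕ.* p ℕ.+ A n m ℕ.* q) (A n (suc m)))
                  (cong (_+ a (suc m)) (trans (ℤP.pos-+ (X ℕ.* p) (A n m ℕ.* q))
                                              (cong₂ _+_ (ℤP.pos-* X p) (ℤP.pos-* (A n m) q))))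
    regroup : ∀ x a₀ a₁ s → x * (1ℤ + s) + a₀ * s + a₁ ≡ a₁ - a₀ + (x + a₀) * (1ℤ + s)
    regroup = solve-∀

  sum-minus-one : ∀ L → sum L (λ _ → -1ℤ) ≡ - + L
  sum-minus-one zero    = refl
  sum-minus-one (suc L) = trans (cong (_+ -1ℤ) (sum-minus-one L)) (step (+ L))
    where step : ∀ x → - x + -1ℤ ≡ - (1ℤ + x)
          step = solve-∀

  -- Σ_{m<q} A(n,m) ≡ 1 (it equals n! = (p-2)!, as Wilson's theorem predicts).
  sum-a≋1 : sum q a ≋ 1ℤ
  sum-a≋1 = begin
    sum q a                                   ≡⟨ sym (weighted-sum-Δ a q) ⟩
    sum q (λ m → (+ q - + m) * Δ a m)         ≈⟨ sum-≋ q (λ m m<q → ≋-*ˡ (+ q - + m) (Δa≋power m (ℕP.≤-pred m<q))) ⟩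
    sum q (λ m → (+ q - + m) * power m)       ≈⟨ sum-≋ q (λ m m<q → weight m (ℕP.≤-pred m<q)) ⟩
    sum q (λ _ → -1ℤ)                         ≡⟨ sum-minus-one q ⟩
    - + q                                     ≡⟨ shift (+ q) ⟩
    1ℤ + -1ℤ * (1ℤ + + q)                     ≡⟨ cong (λ t → 1ℤ + -1ℤ * t) (sym p≡1+q) ⟩
    1ℤ + -1ℤ * + p                            ≈⟨ ≋-multiple 1ℤ -1ℤ ⟩
    1ℤ                                        ∎
    where
    shift : ∀ s → - s ≡ 1ℤ + -1ℤ * (1ℤ + s)
    shift = solve-∀
    -- (q - m) (m+1)^n = p (m+1)^n - (m+1)^(n+1) ≡ -1
    weight : ∀ m → m ≤ n → (+ q - + m) * power m ≋ -1ℤ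
    weight m m≤n = begin
      (+ q - + m) * power m                          ≡⟨ expand (+ q) (+ m) (power m) ⟩
      - ((1ℤ + + m) * power m) + power m * (1ℤ + + q) ≡⟨ cong₂ (λ x y → - (x * power m) + power m * y) (sym (ℤP.pos-+ 1 m)) (sym p≡1+q) ⟩
      - (+ suc m * power m) + power m * + p          ≈⟨ ≋-multiple _ (power m) ⟩
      - (+ suc m * power m)                          ≈⟨ ≋-neg (power-inverse m m≤n) ⟩
      -1ℤ                                            ∎
      where expand : ∀ s k w → (s - k) * w ≡ - ((1ℤ + k) * w) + w * (1ℤ + s)
            expand = solve-∀

  -- 2 Σ_{m<q} (-1)^m a(m) ≡ Σ_{m<q} (-1)^m (m+1)^n, using a(n) = A(n,n) = 0.
  twice-alternating : + 2 * sum q (λ m → sign m * a m) ≋ sum q (λ m → sign m * power m)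
  twice-alternating = begin
    + 2 * sum q (λ m → sign m * a m)                       ≡⟨ drop-last (+ 2 * sum q (λ m → sign m * a m)) (sign n) ⟩
    + 2 * sum q (λ m → sign m * a m) - sign n * + 0        ≡⟨ cong (λ t → + 2 * sum q (λ m → sign m * a m) - sign n * + t) (sym (A-diag n≥1)) ⟩
    + 2 * sum q (λ m → sign m * a m) - sign n * a n        ≡⟨ sym (alternating-sum-Δ a n) ⟩
    sum q (λ m → sign m * Δ a m)                           ≈⟨ sum-≋ q (λ m m<q → ≋-*ˡ (sign m) (Δa≋power m (ℕP.≤-pred m<q))) ⟩
    sum q (λ m → sign m * power m)                         ∎
    where drop-last : ∀ x s → x ≡ x - s * + 0
          drop-last = solve-∀

  -- Σ_{j<m} (-1)^(j+1) (j+1)^n, which is ≡ Σ_{k=1}^m (-1)^k / k.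
  inverse-sum : ℕ → ℤ
  inverse-sum m = sum m (λ j → sign (suc j) * power j)

  main-congruence : + 2 * (+ 1 - + 2 * + N n) ≋ inverse-sum q
  main-congruence = begin
    + 2 * (+ 1 - + 2 * + N n)                ≡⟨ cong (λ t → + 2 * (+ 1 - t)) (twice-N n) ⟩
    + 2 * (+ 1 - (T + E))                    ≡⟨ expand T E ⟩
    (+ 2 + - (+ 2 * T)) + - (+ 2 * E)        ≈⟨ ≋-+ (≋-+ (≋-reflexive {+ 2} refl) (≋-neg (≋-*ˡ (+ 2) sum-a≋1))) (≋-neg twice-alternating) ⟩
    (+ 2 + - (+ 2 * 1ℤ)) + - G               ≡⟨ cancel G ⟩
    -1ℤ * G                                  ≡⟨ sym (sum-*ˡ q -1ℤ _) ⟩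
    sum q (λ j → -1ℤ * (sign j * power j))   ≡⟨ sum-cong q (λ j _ → sym (ℤP.*-assoc -1ℤ (sign j) (power j))) ⟩
    sum q (λ j → -1ℤ * sign j * power j)     ≡⟨ sum-cong q (λ j _ → cong (_* power j) (ℤP.-1*i≡-i (sign j))) ⟩
    inverse-sum q                            ∎
    where
    T E G : ℤ
    T = sum q a
    E = sum q (λ m → sign m * a m)
    G = sum q (λ m → sign m * power m)
    expand : ∀ t e → + 2 * (+ 1 - (t + e)) ≡ (+ 2 + - (+ 2 * t)) + - (+ 2 * e)
    expand = solve-∀
    cancel : ∀ g → (+ 2 + - (+ 2 * 1ℤ)) + - g ≡ -1ℤ * g
    cancel = solve-∀

  scaledHarmonic≋ : ∀ m → m ≤ q → scaledHarmonic m ≋ + (m !) * inverse-sum m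
  scaledHarmonic≋ zero    _      = ≋-reflexive refl
  scaledHarmonic≋ (suc m) m+1≤q = begin
    k * scaledHarmonic m + s * f                  ≈⟨ ≋-+ (≋-*ˡ k (scaledHarmonic≋ m (ℕP.≤-trans (ℕP.n≤1+n m) m+1≤q))) (≋-reflexive {s * f} refl) ⟩
    k * (f * L) + s * f                           ≡⟨ cong (λ t → k * (f * L) + t) (sym (ℤP.*-identityʳ (s * f))) ⟩
    k * (f * L) + s * f * 1ℤ                      ≈⟨ ≋-sym (≋-+ (≋-reflexive {k * (f * L)} refl) (≋-*ˡ (s * f) (power-inverse m (ℕP.≤-pred m+1≤q)))) ⟩
    k * (f * L) + s * f * (k * power m)           ≡⟨ sym (regroup k f L s (power m)) ⟩
    k * f * (L + s * power m)                     ≡⟨ cong (_* inverse-sum (suc m)) (sym (ℤP.pos-* (suc m) (m !))) ⟩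
    + (suc m !) * inverse-sum (suc m)             ∎
    where
    k = + suc m
    f = + (m !)
    s = sign (suc m)
    L = inverse-sum m
    regroup : ∀ k f L s w → k * f * (L + s * w) ≡ k * (f * L) + s * f * (k * w)
    regroup = solve-∀

  scaledHarmonic-mod-p : scaledHarmonic q ≋ + (q !) * (+ 2 * (+ 1 - + 2 * + N n))
  scaledHarmonic-mod-p = begin
    scaledHarmonic q                                 ≈⟨ scaledHarmonic≋ q ℕP.≤-refl ⟩
    + (q !) * inverse-sum q                          ≈⟨ ≋-*ˡ (+ (q !)) (≋-sym main-congruence) ⟩
    + (q !) * (+ 2 * (+ 1 - + 2 * + N n))            ∎

-- Passing to ℚ: c = (H - R) / p satisfies c · (p-1)! ∈ ℤ, so the denominator
-- of c divides (p-1)! and is therefore prime to p.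
module RationalCongruence (n : ℕ) (prime : Prime (suc (suc n))) (n≥1 : 1 ≤ n) where
  open import Data.Nat as ℕ using (_!)
  open import Data.Nat.Divisibility using (_∣_; ∣-trans)
  open import Relation.Nullary using (¬_)
  open import Data.Integer as ℤ using (+_)
  open import Data.Rational as ℚ using (_/_)
  import Data.Rational.Properties as ℚP
  open import Data.Rational.Solver using (module +-*-Solver)
  open +-*-Solver using (solve; _:-_; _:*_; _:=_)
  open import Data.Product using (_,_)
  open import Relation.Binary.PropositionalEquality
  open ≡-Reasoning
  open Fermat prime using (p; ∤-factorial; ∤⇒coprime)
  open Congruence (+ p) using (_≋_)
  open Rationals
  open HarmonicModPrime n prime n≥1 using (q; scaledHarmonic-mod-p)

  R : ℤ
  R = + 2 ℤ.* (+ 1 ℤ.- + 2 ℤ.* + N n)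

  altHarmonic-mod-p : altHarmonic q ≡ (R / 1) [modℚ p ]
  altHarmonic-mod-p = c , ∤⇒coprime p∤↧c , sym p·c≡x
    where
    x = altHarmonic q ℚ.- ι R
    p⁻¹ = + 1 / p
    c = x ℚ.* p⁻¹
    p·c≡x : ι (+ p) ℚ.* c ≡ x
    p·c≡x = begin
      ι (+ p) ℚ.* (x ℚ.* p⁻¹) ≡⟨ solve 3 (λ a b c → a :* (b :* c) := b :* (a :* c)) refl (ι (+ p)) x p⁻¹ ⟩
      x ℚ.* (ι (+ p) ℚ.* p⁻¹) ≡⟨ cong (x ℚ.*_) (ι·reciprocal (suc n)) ⟩
      x ℚ.* ℚ.1ℚ              ≡⟨ ℚP.*-identityʳ x ⟩
      x                       ∎
    F = q !
    w = _≋_.quotient scaledHarmonic-mod-p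
    c·F≡w : c ℚ.* ι (+ F) ≡ ι w
    c·F≡w = begin
      (x ℚ.* p⁻¹) ℚ.* ι (+ F)
        ≡⟨ solve 4 (λ a r i f → ((a :- r) :* i) :* f := (a :* f :- r :* f) :* i) refl (altHarmonic q) (ι R) p⁻¹ (ι (+ F)) ⟩
      (altHarmonic q ℚ.* ι (+ F) ℚ.- ι R ℚ.* ι (+ F)) ℚ.* p⁻¹
        ≡⟨ cong₂ (λ u v → (u ℚ.- v) ℚ.* p⁻¹) (altHarmonic-scaled q) (ι-* R (+ F)) ⟩
      (ι (scaledHarmonic q) ℚ.- ι (R ℤ.* + F)) ℚ.* p⁻¹
        ≡⟨ cong (ℚ._* p⁻¹) (ι-- (scaledHarmonic q) (R ℤ.* + F)) ⟩
      ι (scaledHarmonic q ℤ.- R ℤ.* + F) ℚ.* p⁻¹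
        ≡⟨ cong (λ z → ι (scaledHarmonic q ℤ.- z) ℚ.* p⁻¹) (ℤP.*-comm R (+ F)) ⟩
      ι (scaledHarmonic q ℤ.- + F ℤ.* R) ℚ.* p⁻¹
        ≡⟨ cong (λ z → ι z ℚ.* p⁻¹) (_≋_.equation scaledHarmonic-mod-p) ⟩
      ι (w ℤ.* + p) ℚ.* p⁻¹
        ≡⟨ cong (ℚ._* p⁻¹) (sym (ι-* w (+ p))) ⟩
      (ι w ℚ.* ι (+ p)) ℚ.* p⁻¹
        ≡⟨ ℚP.*-assoc (ι w) (ι (+ p)) p⁻¹ ⟩
      ι w ℚ.* (ι (+ p) ℚ.* p⁻¹)
        ≡⟨ cong (ι w ℚ.*_) (ι·reciprocal (suc n)) ⟩
      ι w ℚ.* ℚ.1ℚ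
        ≡⟨ ℚP.*-identityʳ (ι w) ⟩
      ι w ∎
    p∤↧c : ¬ (p ∣ ℚ.↧ₙ c)
    p∤↧c p∣↧c = ∤-factorial q (ℕP.n<1+n q) (∣-trans p∣↧c (denominator-∣ c F w c·F≡w))

open import Data.Nat using (_%_; _∸_)
open import Data.Integer using (+_; _-_; _*_)
open import Data.Rational using (_/_)
open import Relation.Binary.PropositionalEquality using (_≡_)
open import Data.Empty using (⊥-elim)
open import Data.Nat.Primality using (¬prime[0]; ¬prime[1])

theorem2 : (p : ℕ) → Prime p → p % 2 ≡ 1 →
    altHarmonic (p ∸ 1) ≡ ((+ 2 * (+ 1 - + 2 * + N (p ∸ 2))) / 1) [modℚ p ]
theorem2 0                   p-prime _  = ⊥-elim (¬prime[0] p-prime)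
theorem2 1                   p-prime _  = ⊥-elim (¬prime[1] p-prime)
theorem2 2                   _       ()
theorem2 (suc (suc (suc n))) p-prime _  = RationalCongruence.altHarmonic-mod-p (suc n) p-prime (s≤s z≤n)
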